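{- Every $\Sigma$-formula $\phi$ is $\mathfrak{F}$-equivalent to an $\mathcal{L}_{BT}$-formula of the form $(\exists v_0)(Q_1v_1\sqsubseteq t_1)\cdots(Q_mv_m\sqsubseteq t_m)\,s=t$, where $s,t,t_1,\ldots,t_m$ are terms and $Q_j\in\{\exists,\forall\}$ for $j=1,\ldots,m$. Moreover, if $\phi$ is purely existential, then $\phi$ is $\mathfrak{F}$-equivalent to a formula of the form $\exists v_0\ldots v_m[v_1\sqsubseteq t_1\wedge\cdots\wedge v_m\sqsubseteq t_m\wedge s=t]$.
   Context: Bit strings are elements of $\{\mathbf{0},\mathbf{1}\}^*$; $\varepsilon$ is the empty string, $|\alpha|$ the length. The language $\mathcal{L}_{BT}$ has constant symbols $e,0,1$, binary function symbol $\circ$, and binary relation symbol $\sqsubseteq$. The structure $\mathfrak{F}$ has universe $\{\mathbf{0},\mathbf{1}\}^*$, interprets $e,0,1$ as $\varepsilon,\mathbf{0},\mathbf{1}$, $\circ$ as concatenation, and $\alpha\sqsubseteq\beta$ as $|\alpha|\le|\beta|$. $(\exists x\sqsubseteq t)\phi$ abbreviates $\exists x[x\sqsubseteq t\wedge\phi]$, $(\forall x\sqsubseteq t)\phi$ abbreviates $\forall x[x\sqsubseteq t\to\phi]$. $\Sigma$-formulas: $s\sqsubseteq t$, $\neg s\sqsubseteq t$, $s=t$, $\neg s=t$ (terms $s,t$) are $\Sigma$-formulas; they are closed under $\wedge,\vee$, and under $(\exists x\sqsubseteq t)$, $(\forall x\sqsubseteq t)$ and $\exists x$ where $x$ does not occur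 in $t$. A purely existential formula is a $\Sigma$-formula with no bounded universal quantifiers. Two formulas are $\mathfrak{F}$-equivalent if their biconditional (universally closed) holds in $\mathfrak{F}$. -}

module Defs where

open import Data.Bool using (Bool; true; false)
open import Data.List using (List; []; _∷_; _++_; length)
open import Data.Nat using (ℕ; _≤_)
open import Data.Product using (Σ; _×_; _,_)
open import Data.Sum using (_⊎_)
open import Relation.Binary.PropositionalEquality using (_≡_; _≢_)
open import Relation.Nullary using (¬_)
open import Data.Unit using (⊤)
open import Data.Nat using (_≟_)
open import Relation.Nullary using (yes; no)

BitString : Set
BitString = List Bool

Var : Set
Var = ℕ

data Term : Set where
  var  : Var → Term
  e    : Term
  c0   : Term
  c1   : Term
  _∘ₜ_ : Term → Term → Term

data Fm : Set where
  _≐_  : Term → Term → Fm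
  _⊑_  : Term → Term → Fm
  ¬ᶠ_  : Fm → Fm
  _∧ᶠ_ : Fm → Fm → Fm
  _∨ᶠ_ : Fm → Fm → Fm
  _⇒ᶠ_ : Fm → Fm → Fm
  ∃ᶠ   : Var → Fm → Fm
  ∀ᶠ   : Var → Fm → Fm

∃⊑ : Var → Term → Fm → Fm
∃⊑ x t φ = ∃ᶠ x ((var x ⊑ t) ∧ᶠ φ)

∀⊑ : Var → Term → Fm → Fm
∀⊑ x t φ = ∀ᶠ x ((var x ⊑ t) ⇒ᶠ φ)

OccursIn : Var → Term → Set
OccursIn x (var y)  = x ≡ y
OccursIn x e        = Data.Empty.⊥ where import Data.Empty
OccursIn x c0       = Data.Empty.⊥ where import Data.Empty
OccursIn x c1       = Data.Empty.⊥ where import Data.Empty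
OccursIn x (s ∘ₜ t) = OccursIn x s ⊎ OccursIn x t

Env : Set
Env = Var → BitString

_[_↦_] : Env → Var → BitString → Env
(ρ [ x ↦ a ]) y with y ≟ x
... | yes _ = a
... | no  _ = ρ y

⟦_⟧ₜ : Term → Env → BitString
⟦ var x ⟧ₜ ρ  = ρ x
⟦ e ⟧ₜ ρ      = []
⟦ c0 ⟧ₜ ρ     = false ∷ []
⟦ c1 ⟧ₜ ρ     = true ∷ []
⟦ s ∘ₜ t ⟧ₜ ρ = ⟦ s ⟧ₜ ρ ++ ⟦ t ⟧ₜ ρ

⟦_⟧ : Fm → Env → Set
⟦ s ≐ t ⟧ ρ   = ⟦ s ⟧ₜ ρ ≡ ⟦ t ⟧ₜ ρ
⟦ s ⊑ t ⟧ ρ   = length (⟦ s ⟧ₜ ρ) ≤ length (⟦ t ⟧ₜ ρ)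
⟦ ¬ᶠ φ ⟧ ρ    = ¬ (⟦ φ ⟧ ρ)
⟦ φ ∧ᶠ ψ ⟧ ρ  = ⟦ φ ⟧ ρ × ⟦ ψ ⟧ ρ
⟦ φ ∨ᶠ ψ ⟧ ρ  = ⟦ φ ⟧ ρ ⊎ ⟦ ψ ⟧ ρ
⟦ φ ⇒ᶠ ψ ⟧ ρ  = ⟦ φ ⟧ ρ → ⟦ ψ ⟧ ρ
⟦ ∃ᶠ x φ ⟧ ρ  = Σ BitString (λ a → ⟦ φ ⟧ (ρ [ x ↦ a ]))
⟦ ∀ᶠ x φ ⟧ ρ  = (a : BitString) → ⟦ φ ⟧ (ρ [ x ↦ a ])

_≈𝔉_ : Fm → Fm → Set
φ ≈𝔉 ψ = (ρ : Env) → (⟦ φ ⟧ ρ → ⟦ ψ ⟧ ρ) × (⟦ ψ ⟧ ρ → ⟦ φ ⟧ ρ)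

data IsΣ : Fm → Set where
  eqΣ    : ∀ s t → IsΣ (s ≐ t)
  neqΣ   : ∀ s t → IsΣ (¬ᶠ (s ≐ t))
  leΣ    : ∀ s t → IsΣ (s ⊑ t)
  nleΣ   : ∀ s t → IsΣ (¬ᶠ (s ⊑ t))
  andΣ   : ∀ {φ ψ} → IsΣ φ → IsΣ ψ → IsΣ (φ ∧ᶠ ψ)
  orΣ    : ∀ {φ ψ} → IsΣ φ → IsΣ ψ → IsΣ (φ ∨ᶠ ψ)
  bexΣ   : ∀ {φ} x t → ¬ OccursIn x t → IsΣ φ → IsΣ (∃⊑ x t φ)
  ballΣ  : ∀ {φ} x t → ¬ OccursIn x t → IsΣ φ → IsΣ (∀⊑ x t φ)
  exΣ    : ∀ {φ} x → IsΣ φ → IsΣ (∃ᶠ x φ)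

data IsPE : Fm → Set where
  eqP    : ∀ s t → IsPE (s ≐ t)
  neqP   : ∀ s t → IsPE (¬ᶠ (s ≐ t))
  leP    : ∀ s t → IsPE (s ⊑ t)
  nleP   : ∀ s t → IsPE (¬ᶠ (s ⊑ t))
  andP   : ∀ {φ ψ} → IsPE φ → IsPE ψ → IsPE (φ ∧ᶠ ψ)
  orP    : ∀ {φ ψ} → IsPE φ → IsPE ψ → IsPE (φ ∨ᶠ ψ)
  bexP   : ∀ {φ} x t → ¬ OccursIn x t → IsPE φ → IsPE (∃⊑ x t φ)
  exP    : ∀ {φ} x → IsPE φ → IsPE (∃ᶠ x φ)

data Q : Set where
  qex qall : Q

prefixForm : List (Q × Var × Term) → Term → Term → Fm
prefixForm [] s t = s ≐ t
prefixForm ((qex  , v , u) ∷ qs) s t = ∃⊑ v u (prefixForm qs s t)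
prefixForm ((qall , v , u) ∷ qs) s t = ∀⊑ v u (prefixForm qs s t)

NormalForm : Var → List (Q × Var × Term) → Term → Term → Fm
NormalForm v₀ qs s t = ∃ᶠ v₀ (prefixForm qs s t)

boundConj : List (Var × Term) → Term → Term → Fm
boundConj [] s t = s ≐ t
boundConj ((v , u) ∷ bs) s t = (var v ⊑ u) ∧ᶠ boundConj bs s t

exists* : List Var → Fm → Fm
exists* [] ψ = ψ
exists* (v ∷ vs) ψ = ∃ᶠ v (exists* vs ψ)

ExNormalForm : Var → List (Var × Term) → Term → Term → Fm
ExNormalForm v₀ bs s t = ∃ᶠ v₀ (exists* (Data.List.map (λ p → Data.Product.proj₁ p) bs) (boundConj bs s t))
  where import Data.List; import Data.Product

-- Equations are conjoined by the injective pairing (X, Y) ↦ X0Y X1Y, s ⊑ u becomes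
-- ∃ x ⊑ u. x = s, and an inequation is a length comparison or a first differing bit. A disjunction
-- conjoins two guarded equations, each enforced only when its switch w ⊑ 0 is 0, where w w′ = 0
-- turns on exactly one switch. All unbounded existentials are bounded by the single outer c, which
-- the concatenation of their witnesses dominates; under a bounded universal quantifier this needs
-- collection: the finitely many strings below a bound have witnesses of uniformly bounded length.
-- Without bounded ∀ the prefix is existential and unfolds into a conjunction of bounds.

module Submission where

open import Defs
open import Data.Bool using (Bool; true; false; T; _∧_)
open import Data.Bool.Properties using (T-∧)
open import Data.Empty using (⊥-elim)
open import Data.List using (List; []; _∷_; _++_; length; map; replicate)
open import Data.List.Properties
  using (∷-injective; ∷-injectiveˡ; ∷-injectiveʳ; ++-cancelˡ; ++-assoc; ++-identityʳ; length-++; length-++-≤ˡ; length-++-≤ʳ;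
         length-replicate)
open import Data.List.Membership.Propositional using (_∉_)
open import Data.List.Relation.Unary.All using (All; []; _∷_)
import Data.List.Relation.Unary.All as All
open import Data.List.Relation.Unary.All.Properties using (++⁺)
open import Data.List.Relation.Unary.Any using (here; there)
open import Data.Nat using (ℕ; zero; suc; _+_; _≤_; _<_; _⊔_; z≤n; s≤s; _≟_; _≤?_)
open import Data.Nat.Properties
open import Data.Product using (Σ; _×_; ∃-syntax; _,_; proj₁; proj₂)
open import Data.Sum using (_⊎_; inj₁; inj₂)
import Data.Sum as Sum
open import Data.Unit using (⊤; tt)
open import Function using (_∘_; Equivalence)
open import Relation.Binary.Bundles using (Setoid)
import Relation.Binary.Reasoning.Setoid
open import Relation.Binary.PropositionalEquality
open import Relation.Nullary using (¬_; yes; no)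
open import Relation.Unary using (_⊆_; U; _∪_; ｛_｝)

infix 2 _⟺_

_⟺_ : Set → Set → Set
A ⟺ B = (A → B) × (B → A)

⟺-sym : ∀ {A B} → A ⟺ B → B ⟺ A
⟺-sym (f , g) = g , f

⟺-trans : ∀ {A B C} → A ⟺ B → B ⟺ C → A ⟺ C
⟺-trans (f , g) (h , k) = h ∘ f , g ∘ k

update-same : ∀ ρ x a → (ρ [ x ↦ a ]) x ≡ a
update-same ρ x a with x ≟ x
... | yes _ = refl
... | no x≢x = ⊥-elim (x≢x refl)

update-other : ∀ ρ {x y} a → y ≢ x → (ρ [ x ↦ a ]) y ≡ ρ y
update-other ρ {x} {y} a y≢x with y ≟ x
... | yes y≡x = ⊥-elim (y≢x y≡x)
... | no _ = refl

Allₜ : (Var → Set) → Term → Set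
Allₜ S (var x) = S x
Allₜ S e = ⊤
Allₜ S c0 = ⊤
Allₜ S c1 = ⊤
Allₜ S (s ∘ₜ t) = Allₜ S s × Allₜ S t

Allᶠ : (Var → Set) → Fm → Set
Allᶠ S (s ≐ t) = Allₜ S s × Allₜ S t
Allᶠ S (s ⊑ t) = Allₜ S s × Allₜ S t
Allᶠ S (¬ᶠ φ) = Allᶠ S φ
Allᶠ S (φ ∧ᶠ ψ) = Allᶠ S φ × Allᶠ S ψ
Allᶠ S (φ ∨ᶠ ψ) = Allᶠ S φ × Allᶠ S ψ
Allᶠ S (φ ⇒ᶠ ψ) = Allᶠ S φ × Allᶠ S ψ
Allᶠ S (∃ᶠ x φ) = S x × Allᶠ S φ
Allᶠ S (∀ᶠ x φ) = S x × Allᶠ S φ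

Allₜ-mono : ∀ {S S′} → S ⊆ S′ → ∀ t → Allₜ S t → Allₜ S′ t
Allₜ-mono f (var x) h = f h
Allₜ-mono f e h = tt
Allₜ-mono f c0 h = tt
Allₜ-mono f c1 h = tt
Allₜ-mono f (s ∘ₜ t) (hs , ht) = Allₜ-mono f s hs , Allₜ-mono f t ht

Allᶠ-mono : ∀ {S S′} → S ⊆ S′ → ∀ φ → Allᶠ S φ → Allᶠ S′ φ
Allᶠ-mono f (s ≐ t) (hs , ht) = Allₜ-mono f s hs , Allₜ-mono f t ht
Allᶠ-mono f (s ⊑ t) (hs , ht) = Allₜ-mono f s hs , Allₜ-mono f t ht
Allᶠ-mono f (¬ᶠ φ) h = Allᶠ-mono f φ h
Allᶠ-mono f (φ ∧ᶠ ψ) (hφ , hψ) = Allᶠ-mono f φ hφ , Allᶠ-mono f ψ hψ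
Allᶠ-mono f (φ ∨ᶠ ψ) (hφ , hψ) = Allᶠ-mono f φ hφ , Allᶠ-mono f ψ hψ
Allᶠ-mono f (φ ⇒ᶠ ψ) (hφ , hψ) = Allᶠ-mono f φ hφ , Allᶠ-mono f ψ hψ
Allᶠ-mono f (∃ᶠ x φ) (hx , hφ) = f hx , Allᶠ-mono f φ hφ
Allᶠ-mono f (∀ᶠ x φ) (hx , hφ) = f hx , Allᶠ-mono f φ hφ

Allₜ-U : ∀ t → Allₜ U t
Allₜ-U (var x) = tt
Allₜ-U e = tt
Allₜ-U c0 = tt
Allₜ-U c1 = tt
Allₜ-U (s ∘ₜ t) = Allₜ-U s , Allₜ-U t

Allᶠ-U : ∀ φ → Allᶠ U φ
Allᶠ-U (s ≐ t) = Allₜ-U s , Allₜ-U t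
Allᶠ-U (s ⊑ t) = Allₜ-U s , Allₜ-U t
Allᶠ-U (¬ᶠ φ) = Allᶠ-U φ
Allᶠ-U (φ ∧ᶠ ψ) = Allᶠ-U φ , Allᶠ-U ψ
Allᶠ-U (φ ∨ᶠ ψ) = Allᶠ-U φ , Allᶠ-U ψ
Allᶠ-U (φ ⇒ᶠ ψ) = Allᶠ-U φ , Allᶠ-U ψ
Allᶠ-U (∃ᶠ x φ) = tt , Allᶠ-U φ
Allᶠ-U (∀ᶠ x φ) = tt , Allᶠ-U φ

Agree : (Var → Set) → Env → Env → Set
Agree S ρ ρ′ = ∀ v → S v → ρ v ≡ ρ′ v

Agree-update : ∀ {S ρ ρ′} → Agree S ρ ρ′ → ∀ x a → Agree S (ρ [ x ↦ a ]) (ρ′ [ x ↦ a ])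
Agree-update ag x a v h with v ≟ x
... | yes _ = refl
... | no _ = ag v h

update-agree : ∀ ρ x a → Agree (_≢ x) (ρ [ x ↦ a ]) ρ
update-agree ρ x a v = update-other ρ a

⟦⟧ₜ-agree : ∀ {S ρ ρ′} t → Allₜ S t → Agree S ρ ρ′ → ⟦ t ⟧ₜ ρ ≡ ⟦ t ⟧ₜ ρ′
⟦⟧ₜ-agree (var x) h ag = ag x h
⟦⟧ₜ-agree e _ _ = refl
⟦⟧ₜ-agree c0 _ _ = refl
⟦⟧ₜ-agree c1 _ _ = refl
⟦⟧ₜ-agree (s ∘ₜ t) (hs , ht) ag = cong₂ _++_ (⟦⟧ₜ-agree s hs ag) (⟦⟧ₜ-agree t ht ag)

⟦⟧-agree : ∀ {S} φ → Allᶠ S φ → ∀ {ρ ρ′} → Agree S ρ ρ′ → ⟦ φ ⟧ ρ ⟺ ⟦ φ ⟧ ρ′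
⟦⟧-agree (s ≐ t) (hs , ht) ag =
  (λ p → trans (sym (⟦⟧ₜ-agree s hs ag)) (trans p (⟦⟧ₜ-agree t ht ag))) ,
  (λ p → trans (⟦⟧ₜ-agree s hs ag) (trans p (sym (⟦⟧ₜ-agree t ht ag))))
⟦⟧-agree (s ⊑ t) (hs , ht) ag =
  subst₂ _≤_ (cong length (⟦⟧ₜ-agree s hs ag)) (cong length (⟦⟧ₜ-agree t ht ag)) ,
  subst₂ _≤_ (cong length (sym (⟦⟧ₜ-agree s hs ag))) (cong length (sym (⟦⟧ₜ-agree t ht ag)))
⟦⟧-agree (¬ᶠ φ) h ag with ⟦⟧-agree φ h ag
... | to , from = (λ ¬p → ¬p ∘ from) , (λ ¬p → ¬p ∘ to)
⟦⟧-agree (φ ∧ᶠ ψ) (hφ , hψ) ag with ⟦⟧-agree φ hφ ag | ⟦⟧-agree ψ hψ ag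
... | to₁ , from₁ | to₂ , from₂ = (λ (p , q) → to₁ p , to₂ q) , (λ (p , q) → from₁ p , from₂ q)
⟦⟧-agree (φ ∨ᶠ ψ) (hφ , hψ) ag with ⟦⟧-agree φ hφ ag | ⟦⟧-agree ψ hψ ag
... | to₁ , from₁ | to₂ , from₂ = Sum.map to₁ to₂ , Sum.map from₁ from₂
⟦⟧-agree (φ ⇒ᶠ ψ) (hφ , hψ) ag with ⟦⟧-agree φ hφ ag | ⟦⟧-agree ψ hψ ag
... | to₁ , from₁ | to₂ , from₂ = (λ f → to₂ ∘ f ∘ from₁) , (λ f → from₂ ∘ f ∘ to₁)
⟦⟧-agree (∃ᶠ x φ) (_ , h) ag =
  (λ (a , p) → a , proj₁ (⟦⟧-agree φ h (Agree-update ag x a)) p) ,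
  (λ (a , p) → a , proj₂ (⟦⟧-agree φ h (Agree-update ag x a)) p)
⟦⟧-agree (∀ᶠ x φ) (_ , h) ag =
  (λ f a → proj₁ (⟦⟧-agree φ h (Agree-update ag x a)) (f a)) ,
  (λ f a → proj₂ (⟦⟧-agree φ h (Agree-update ag x a)) (f a))

⟦⟧ₜ-update-fresh : ∀ ρ x a t → Allₜ (_≢ x) t → ⟦ t ⟧ₜ (ρ [ x ↦ a ]) ≡ ⟦ t ⟧ₜ ρ
⟦⟧ₜ-update-fresh ρ x a t h = ⟦⟧ₜ-agree t h (update-agree ρ x a)

⟦⟧-update-fresh : ∀ φ x → Allᶠ (_≢ x) φ → ∀ ρ a → ⟦ φ ⟧ (ρ [ x ↦ a ]) ⟺ ⟦ φ ⟧ ρ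
⟦⟧-update-fresh φ x h ρ a = ⟦⟧-agree φ h (update-agree ρ x a)

infix 2 _≋_

record _≋_ (φ ψ : Fm) : Set where
  constructor mk≋
  field at : ∀ ρ → ⟦ φ ⟧ ρ ⟺ ⟦ ψ ⟧ ρ
open _≋_ public

≋-refl : ∀ {φ} → φ ≋ φ
≋-refl = mk≋ λ ρ → (λ p → p) , (λ p → p)

≋-sym : ∀ {φ ψ} → φ ≋ ψ → ψ ≋ φ
≋-sym h = mk≋ λ ρ → ⟺-sym (at h ρ)

≋-trans : ∀ {φ ψ χ} → φ ≋ ψ → ψ ≋ χ → φ ≋ χ
≋-trans h g = mk≋ λ ρ → ⟺-trans (at h ρ) (at g ρ)

≋-setoid : Setoid _ _
≋-setoid = record
  { Carrier = Fm ; _≈_ = _≋_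
  ; isEquivalence = record { refl = ≋-refl ; sym = ≋-sym ; trans = ≋-trans } }

module ≋-Reasoning = Relation.Binary.Reasoning.Setoid ≋-setoid

∧-cong : ∀ {φ φ′ ψ ψ′} → φ ≋ φ′ → ψ ≋ ψ′ → (φ ∧ᶠ ψ) ≋ (φ′ ∧ᶠ ψ′)
∧-cong h g = mk≋ λ ρ → (λ (p , q) → proj₁ (at h ρ) p , proj₁ (at g ρ) q) ,
                       (λ (p , q) → proj₂ (at h ρ) p , proj₂ (at g ρ) q)

∧-comm : ∀ {φ ψ} → (φ ∧ᶠ ψ) ≋ (ψ ∧ᶠ φ)
∧-comm = mk≋ λ ρ → (λ (p , q) → q , p) , (λ (p , q) → q , p)

∃-cong : ∀ {φ ψ} x → φ ≋ ψ → ∃ᶠ x φ ≋ ∃ᶠ x ψ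
∃-cong x h = mk≋ λ ρ → (λ (a , p) → a , proj₁ (at h _) p) , (λ (a , p) → a , proj₂ (at h _) p)

∃-vacuous : ∀ φ x → Allᶠ (_≢ x) φ → ∃ᶠ x φ ≋ φ
∃-vacuous φ x h = mk≋ λ ρ → (λ (a , p) → proj₁ (⟦⟧-update-fresh φ x h ρ a) p) ,
                            (λ p → [] , proj₂ (⟦⟧-update-fresh φ x h ρ []) p)

bounded : Q → Var → Term → Fm → Fm
bounded qex = ∃⊑
bounded qall = ∀⊑

Prefix : Set
Prefix = List (Q × Var × Term)

prefixed : Prefix → Fm → Fm
prefixed [] M = M
prefixed ((q , v , u) ∷ qs) M = bounded q v u (prefixed qs M)

prefixForm≡prefixed : ∀ qs s t → prefixForm qs s t ≡ prefixed qs (s ≐ t)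
prefixForm≡prefixed [] s t = refl
prefixForm≡prefixed ((qex , v , u) ∷ qs) s t = cong (∃⊑ v u) (prefixForm≡prefixed qs s t)
prefixForm≡prefixed ((qall , v , u) ∷ qs) s t = cong (∀⊑ v u) (prefixForm≡prefixed qs s t)

prefixed-++ : ∀ q₁ q₂ M → prefixed (q₁ ++ q₂) M ≡ prefixed q₁ (prefixed q₂ M)
prefixed-++ [] q₂ M = refl
prefixed-++ ((q , v , u) ∷ q₁) q₂ M = cong (bounded q v u) (prefixed-++ q₁ q₂ M)

NotBound : Prefix → Var → Set
NotBound qs v = All (λ (_ , x , _) → v ≢ x) qs

Allᵖ : (Var → Set) → Prefix → Set
Allᵖ S = All (λ (_ , x , u) → S x × Allₜ S u)

Allᵖ-mono : ∀ {S S′} → S ⊆ S′ → ∀ qs → Allᵖ S qs → Allᵖ S′ qs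
Allᵖ-mono f [] [] = []
Allᵖ-mono f ((_ , _ , u) ∷ qs) ((hx , hu) ∷ h) = (f hx , Allₜ-mono f u hu) ∷ Allᵖ-mono f qs h

Allᶠ-prefixed : ∀ {S} qs M → Allᵖ S qs → Allᶠ S M → Allᶠ S (prefixed qs M)
Allᶠ-prefixed [] M [] h = h
Allᶠ-prefixed ((qex , x , u) ∷ qs) M ((hx , hu) ∷ hqs) h = hx , (hx , hu) , Allᶠ-prefixed qs M hqs h
Allᶠ-prefixed ((qall , x , u) ∷ qs) M ((hx , hu) ∷ hqs) h = hx , (hx , hu) , Allᶠ-prefixed qs M hqs h

Existential : Prefix → Set
Existential = All (λ (q , _) → q ≡ qex)

ε-⊑ : ∀ ρ v u → ⟦ var v ⊑ u ⟧ (ρ [ v ↦ [] ])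
ε-⊑ ρ v u = subst (λ w → length w ≤ length (⟦ u ⟧ₜ (ρ [ v ↦ [] ]))) (sym (update-same ρ v [])) z≤n

bounded-cong : ∀ q {v u φ ψ ρ} → (∀ a → ⟦ φ ⟧ (ρ [ v ↦ a ]) ⟺ ⟦ ψ ⟧ (ρ [ v ↦ a ])) →
               ⟦ bounded q v u φ ⟧ ρ ⟺ ⟦ bounded q v u ψ ⟧ ρ
bounded-cong qex h = (λ (a , b , p) → a , b , proj₁ (h a) p) , (λ (a , b , p) → a , b , proj₂ (h a) p)
bounded-cong qall h = (λ f a b → proj₁ (h a) (f a b)) , (λ f a b → proj₂ (h a) (f a b))

bounded-intro : ∀ q {v u φ ρ} → (∀ a → ⟦ φ ⟧ (ρ [ v ↦ a ])) → ⟦ bounded q v u φ ⟧ ρ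
bounded-intro qex {v} {u} {ρ = ρ} h = [] , ε-⊑ ρ v u , h []
bounded-intro qall h = λ a _ → h a

bounded-∧ : ∀ q {v u φ} F → Allᶠ (_≢ v) F → (bounded q v u φ ∧ᶠ F) ≋ bounded q v u (φ ∧ᶠ F)
bounded-∧ qex {v} F hF = mk≋ λ ρ →
  (λ ((a , b , p) , f) → a , b , p , proj₂ (⟦⟧-update-fresh F v hF ρ a) f) ,
  (λ (a , b , p , f) → (a , b , p) , proj₁ (⟦⟧-update-fresh F v hF ρ a) f)
bounded-∧ qall {v} {u} F hF = mk≋ λ ρ →
  (λ (g , f) a b → g a b , proj₂ (⟦⟧-update-fresh F v hF ρ a) f) ,
  (λ g → (λ a b → proj₁ (g a b)) ,
         proj₁ (⟦⟧-update-fresh F v hF ρ []) (proj₂ (g [] (ε-⊑ ρ v u))))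

bounded-cong-≋ : ∀ q {v u φ ψ} → φ ≋ ψ → bounded q v u φ ≋ bounded q v u ψ
bounded-cong-≋ q h = mk≋ λ ρ → bounded-cong q λ a → at h _

prefixed-cong : ∀ qs {M M′} → M ≋ M′ → prefixed qs M ≋ prefixed qs M′
prefixed-cong [] h = h
prefixed-cong ((q , v , u) ∷ qs) h = bounded-cong-≋ q (prefixed-cong qs h)

prefixed-cong-under : ∀ qs {M M′} G → Allᶠ (NotBound qs) G →
  (∀ ρ → ⟦ G ⟧ ρ → ⟦ M ⟧ ρ ⟺ ⟦ M′ ⟧ ρ) → ∀ ρ → ⟦ G ⟧ ρ → ⟦ prefixed qs M ⟧ ρ ⟺ ⟦ prefixed qs M′ ⟧ ρ
prefixed-cong-under [] G hG h = h
prefixed-cong-under ((q , v , u) ∷ qs) G hG h ρ g = bounded-cong q λ a →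
  prefixed-cong-under qs G (Allᶠ-mono All.tail G hG) h _
    (proj₂ (⟦⟧-update-fresh G v (Allᶠ-mono All.head G hG) ρ a) g)

prefixed-intro-under : ∀ qs {M} G → Allᶠ (NotBound qs) G →
  (∀ ρ → ⟦ G ⟧ ρ → ⟦ M ⟧ ρ) → ∀ ρ → ⟦ G ⟧ ρ → ⟦ prefixed qs M ⟧ ρ
prefixed-intro-under [] G hG h = h
prefixed-intro-under ((q , v , u) ∷ qs) G hG h ρ g = bounded-intro q λ a →
  prefixed-intro-under qs G (Allᶠ-mono All.tail G hG) h _
    (proj₂ (⟦⟧-update-fresh G v (Allᶠ-mono All.head G hG) ρ a) g)

∧-prefixed : ∀ qs {M} F → Allᶠ (NotBound qs) F → (prefixed qs M ∧ᶠ F) ≋ prefixed qs (M ∧ᶠ F)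
∧-prefixed [] F hF = ≋-refl
∧-prefixed ((q , v , u) ∷ qs) F hF =
  ≋-trans (bounded-∧ q F (Allᶠ-mono All.head F hF))
          (bounded-cong-≋ q (∧-prefixed qs F (Allᶠ-mono All.tail F hF)))

prefixed-∧-prefixed : ∀ q₁ q₂ M₁ M₂ → Allᶠ (NotBound q₁) (prefixed q₂ M₂) → Allᶠ (NotBound q₂) M₁ →
  (prefixed q₁ M₁ ∧ᶠ prefixed q₂ M₂) ≋ prefixed (q₁ ++ q₂) (M₁ ∧ᶠ M₂)
prefixed-∧-prefixed q₁ q₂ M₁ M₂ h₁ h₂ = begin
  prefixed q₁ M₁ ∧ᶠ prefixed q₂ M₂         ≈⟨ ∧-prefixed q₁ _ h₁ ⟩
  prefixed q₁ (M₁ ∧ᶠ prefixed q₂ M₂)       ≈⟨ prefixed-cong q₁ ∧-comm ⟩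
  prefixed q₁ (prefixed q₂ M₂ ∧ᶠ M₁)       ≈⟨ prefixed-cong q₁ (∧-prefixed q₂ M₁ h₂) ⟩
  prefixed q₁ (prefixed q₂ (M₂ ∧ᶠ M₁))     ≈⟨ prefixed-cong q₁ (prefixed-cong q₂ ∧-comm) ⟩
  prefixed q₁ (prefixed q₂ (M₁ ∧ᶠ M₂))     ≡⟨ sym (prefixed-++ q₁ q₂ _) ⟩
  prefixed (q₁ ++ q₂) (M₁ ∧ᶠ M₂)           ∎
  where open ≋-Reasoning

Window : ℕ → ℕ → Prefix → Set
Window lo hi [] = lo ≤ hi
Window lo hi ((_ , v , u) ∷ qs) = lo ≤ v × Allₜ (_< v) u × Window (suc v) hi qs

Window-≤ : ∀ {lo hi} qs → Window lo hi qs → lo ≤ hi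
Window-≤ [] h = h
Window-≤ (_ ∷ qs) (lo≤v , _ , w) = ≤-trans lo≤v (≤-trans (n≤1+n _) (Window-≤ qs w))

Window-lower : ∀ {lo lo′ hi} qs → lo′ ≤ lo → Window lo hi qs → Window lo′ hi qs
Window-lower [] p h = ≤-trans p h
Window-lower (_ ∷ qs) p (lo≤v , hu , w) = ≤-trans p lo≤v , hu , w

Window-++ : ∀ {lo mid hi} q₁ q₂ → Window lo mid q₁ → Window mid hi q₂ → Window lo hi (q₁ ++ q₂)
Window-++ [] q₂ h₁ h₂ = Window-lower q₂ h₁ h₂
Window-++ (_ ∷ q₁) q₂ (lo≤v , hu , w) h₂ = lo≤v , hu , Window-++ q₁ q₂ w h₂

Window-NotBound : ∀ {lo hi} qs → Window lo hi qs → ∀ {v} → v < lo ⊎ hi ≤ v → NotBound qs v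
Window-NotBound [] h o = []
Window-NotBound ((_ , x , _) ∷ qs) (lo≤x , _ , w) (inj₁ v<lo) =
  <⇒≢ (<-≤-trans v<lo lo≤x) ∷ Window-NotBound qs w (inj₁ (<-≤-trans v<lo (≤-trans lo≤x (n≤1+n x))))
Window-NotBound ((_ , x , _) ∷ qs) (_ , _ , w) (inj₂ hi≤v) =
  (λ v≡x → <⇒≱ (Window-≤ qs w) (subst (_ ≤_) v≡x hi≤v)) ∷ Window-NotBound qs w (inj₂ hi≤v)

-- Combinatorics of bit strings

++-injective : ∀ (A : BitString) {B C D} → length A ≡ length C → A ++ B ≡ C ++ D → A ≡ C × B ≡ D
++-injective [] {C = []} _ eq = refl , eq
++-injective (a ∷ A) {C = c ∷ C} l eq with refl , eq′ ← ∷-injective eq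
  with refl , B≡D ← ++-injective A {C = C} (suc-injective l) eq′ = refl , B≡D

m+m≡n+n⇒m≡n : ∀ {m n} → m + m ≡ n + n → m ≡ n
m+m≡n+n⇒m≡n {zero} {zero} eq = refl
m+m≡n+n⇒m≡n {suc m} {suc n} eq =
  cong suc (m+m≡n+n⇒m≡n (suc-injective (trans (sym (+-suc m m)) (trans (suc-injective eq) (+-suc n n)))))

pivot-unique : ∀ (X X′ : BitString) {Y Y′ Z Z′} →
  X ++ false ∷ Y ≡ X′ ++ false ∷ Y′ → X ++ true ∷ Z ≡ X′ ++ true ∷ Z′ → X ≡ X′
pivot-unique [] [] _ _ = refl
pivot-unique [] (false ∷ X′) _ ()
pivot-unique [] (true ∷ X′) () _
pivot-unique (false ∷ X) [] _ ()
pivot-unique (true ∷ X) [] () _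
pivot-unique (x ∷ X) (x′ ∷ X′) eq₀ eq₁ with refl , eq₀′ ← ∷-injective eq₀ =
  cong (x ∷_) (pivot-unique X X′ eq₀′ (∷-injectiveʳ eq₁))

pair : BitString → BitString → BitString
pair X Y = (X ++ false ∷ Y) ++ (X ++ true ∷ Y)

length-pair : ∀ X Y → length (pair X Y) ≡ length (X ++ false ∷ Y) + length (X ++ false ∷ Y)
length-pair X Y = trans (length-++ (X ++ false ∷ Y))
  (cong (length (X ++ false ∷ Y) +_) (trans (length-++ X) (sym (length-++ X))))

pair-injective : ∀ X Y X′ Y′ → pair X Y ≡ pair X′ Y′ → X ≡ X′ × Y ≡ Y′
pair-injective X Y X′ Y′ eq
  with eq₀ , eq₁ ← ++-injective (X ++ false ∷ Y) (m+m≡n+n⇒m≡n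
         (trans (sym (length-pair X Y)) (trans (cong length eq) (length-pair X′ Y′)))) eq
  with refl ← pivot-unique X X′ eq₀ eq₁ = refl , ∷-injectiveʳ (++-cancelˡ X _ _ eq₀)

Zeros : BitString → Set
Zeros = All (_≡ false)

commutes-with-0⇒Zeros : ∀ P → P ++ false ∷ [] ≡ false ∷ P → Zeros P
commutes-with-0⇒Zeros [] eq = []
commutes-with-0⇒Zeros (x ∷ P) eq with refl , eq′ ← ∷-injective eq = refl ∷ commutes-with-0⇒Zeros P eq′

Zeros⇒no-1 : ∀ {P} → Zeros P → ∀ (xs : BitString) {ys} → P ≢ xs ++ true ∷ ys
Zeros⇒no-1 (() ∷ _) [] refl
Zeros⇒no-1 (_ ∷ zs) (x ∷ xs) eq = Zeros⇒no-1 zs xs (∷-injectiveʳ eq)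

delimited-injective : ∀ S T {P Q} → Zeros P → Zeros Q →
  true ∷ (S ++ true ∷ P) ≡ Q ++ true ∷ (T ++ true ∷ []) → S ≡ T
delimited-injective S T {Q = []} zP [] eq = go S T zP (∷-injectiveʳ eq)
  where
  go : ∀ S T {P} → Zeros P → S ++ true ∷ P ≡ T ++ true ∷ [] → S ≡ T
  go [] [] _ _ = refl
  go [] (x ∷ T) zP eq = ⊥-elim (Zeros⇒no-1 zP T (∷-injectiveʳ eq))
  go (x ∷ []) [] _ ()
  go (x ∷ _ ∷ S) [] _ ()
  go (x ∷ S) (y ∷ T) zP eq with refl , eq′ ← ∷-injective eq = cong (x ∷_) (go S T zP eq′)
delimited-injective S T {Q = _ ∷ _} zP (q≡0 ∷ _) eq with () ← trans (∷-injectiveˡ eq) q≡0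

Forks : BitString → BitString → BitString → BitString → BitString → Set
Forks xs ys p q r = xs ≡ p ++ false ∷ q × ys ≡ p ++ true ∷ r

Diverge : BitString → BitString → Set
Diverge xs ys = ∃[ p ] ∃[ q ] ∃[ r ] (Forks xs ys p q r ⊎ Forks ys xs p q r)

Differ : BitString → BitString → Set
Differ xs ys = length ys < length xs ⊎ length xs < length ys ⊎ Diverge xs ys

Differ-∷ : ∀ b {xs ys} → Differ xs ys → Differ (b ∷ xs) (b ∷ ys)
Differ-∷ b (inj₁ l) = inj₁ (s≤s l)
Differ-∷ b (inj₂ (inj₁ l)) = inj₂ (inj₁ (s≤s l))
Differ-∷ b (inj₂ (inj₂ (p , q , r , fork))) = inj₂ (inj₂ (b ∷ p , q , r , Sum.map cons cons fork))
  where
  cons : ∀ {xs ys} → Forks xs ys p q r → Forks (b ∷ xs) (b ∷ ys) (b ∷ p) q r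
  cons (eq₀ , eq₁) = cong (b ∷_) eq₀ , cong (b ∷_) eq₁

≢⇒Differ : ∀ xs ys → xs ≢ ys → Differ xs ys
≢⇒Differ [] [] xs≢ys = ⊥-elim (xs≢ys refl)
≢⇒Differ [] (y ∷ ys) _ = inj₂ (inj₁ (s≤s z≤n))
≢⇒Differ (x ∷ xs) [] _ = inj₁ (s≤s z≤n)
≢⇒Differ (false ∷ xs) (true ∷ ys) _ = inj₂ (inj₂ ([] , xs , ys , inj₁ (refl , refl)))
≢⇒Differ (true ∷ xs) (false ∷ ys) _ = inj₂ (inj₂ ([] , ys , xs , inj₂ (refl , refl)))
≢⇒Differ (false ∷ xs) (false ∷ ys) ne = Differ-∷ false (≢⇒Differ xs ys (ne ∘ cong (false ∷_)))
≢⇒Differ (true ∷ xs) (true ∷ ys) ne = Differ-∷ true (≢⇒Differ xs ys (ne ∘ cong (true ∷_)))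

Differ⇒≢ : ∀ xs ys → Differ xs ys → xs ≢ ys
Differ⇒≢ xs ys (inj₁ l) refl = <-irrefl refl l
Differ⇒≢ xs ys (inj₂ (inj₁ l)) refl = <-irrefl refl l
Differ⇒≢ xs ys (inj₂ (inj₂ (p , q , r , inj₁ (eq₀ , eq₁)))) refl
  with () ← ∷-injective (++-cancelˡ p _ _ (trans (sym eq₀) eq₁))
Differ⇒≢ xs ys (inj₂ (inj₂ (p , q , r , inj₂ (eq₀ , eq₁)))) refl
  with () ← ∷-injective (++-cancelˡ p _ _ (trans (sym eq₀) eq₁))

collection : ∀ n {P : BitString → BitString → Set} → (∀ α → length α ≤ n → Σ BitString (P α)) →
             ∃[ M ] (∀ α → length α ≤ n → ∃[ β ] length β ≤ M × P α β)
collection zero f with β₀ , p₀ ← f [] z≤n = length β₀ , λ where [] z≤n → β₀ , ≤-refl , p₀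
collection (suc n) {P} f
  with β₀ , p₀ ← f [] z≤n
  with M₀ , g₀ ← collection n {P ∘ (false ∷_)} (λ α l → f (false ∷ α) (s≤s l))
  with M₁ , g₁ ← collection n {P ∘ (true ∷_)} (λ α l → f (true ∷ α) (s≤s l))
  = length β₀ ⊔ (M₀ ⊔ M₁) , λ where
    [] _ → β₀ , m≤m⊔n _ _ , p₀
    (false ∷ α) (s≤s l) → let β , lβ , p = g₀ α l in β , ≤-trans lβ (≤-trans (m≤m⊔n M₀ M₁) (m≤n⊔m (length β₀) _)) , p
    (true ∷ α) (s≤s l) → let β , lβ , p = g₁ α l in β , ≤-trans lβ (≤-trans (m≤n⊔m M₀ M₁) (m≤n⊔m (length β₀) _)) , p

⊑-update : ∀ ρ x α u → Allₜ (_≢ x) u →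
  ⟦ var x ⊑ u ⟧ (ρ [ x ↦ α ]) ⟺ (length α ≤ length (⟦ u ⟧ₜ ρ))
⊑-update ρ x α u h =
  subst₂ _≤_ (cong length (update-same ρ x α)) (cong length (⟦⟧ₜ-update-fresh ρ x α u h)) ,
  subst₂ _≤_ (cong length (sym (update-same ρ x α))) (cong length (sym (⟦⟧ₜ-update-fresh ρ x α u h)))

⊑-var : ∀ ρ x α c {γ} → x ≢ c → ρ c ≡ γ → ⟦ var x ⊑ var c ⟧ (ρ [ x ↦ α ]) ⟺ (length α ≤ length γ)
⊑-var ρ x α c x≢c refl = ⊑-update ρ x α (var c) (≢-sym x≢c)

∃⊑-≐ : ∀ ρ x s u → Allₜ (_≢ x) s → Allₜ (_≢ x) u →
  ⟦ ∃⊑ x u (var x ≐ s) ⟧ ρ ⟺ (length (⟦ s ⟧ₜ ρ) ≤ length (⟦ u ⟧ₜ ρ))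
∃⊑-≐ ρ x s u hs hu =
  (λ (α , α⊑u , x≡s) → subst (λ z → length z ≤ length (⟦ u ⟧ₜ ρ))
      (trans (sym (update-same ρ x α)) (trans x≡s (⟦⟧ₜ-update-fresh ρ x α s hs)))
      (proj₁ (⊑-update ρ x α u hu) α⊑u)) ,
  (λ s⊑u → ⟦ s ⟧ₜ ρ , proj₂ (⊑-update ρ x _ u hu) s⊑u ,
      trans (update-same ρ x _) (sym (⟦⟧ₜ-update-fresh ρ x _ s hs)))

⟦⟧-update-fresh-under : ∀ F c → Allᶠ (_≢ c) F → ∀ x ρ γ α →
  ⟦ F ⟧ ((ρ [ c ↦ γ ]) [ x ↦ α ]) ⟺ ⟦ F ⟧ (ρ [ x ↦ α ])
⟦⟧-update-fresh-under F c h x ρ γ α = ⟦⟧-agree F h (Agree-update (update-agree ρ c γ) x α)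

-- Two unbounded witnesses are both bounded by their concatenation.
∃-merge : ∀ c a b A B → a ≢ c → b ≢ c → Allᶠ (_≢ c) A → Allᶠ (_≢ c) B →
  ∃ᶠ c (∃⊑ a (var c) A ∧ᶠ ∃⊑ b (var c) B) ≋ (∃ᶠ a A ∧ᶠ ∃ᶠ b B)
∃-merge c a b A B a≢c b≢c hA hB = mk≋ λ ρ →
  (λ (γ , (α , _ , pA) , (β , _ , pB)) →
     (α , proj₁ (⟦⟧-update-fresh-under A c hA a ρ γ α) pA) , (β , proj₁ (⟦⟧-update-fresh-under B c hB b ρ γ β) pB)) ,
  (λ ((α , pA) , (β , pB)) → α ++ β ,
     (α , proj₂ (⊑-var _ a α c a≢c (update-same ρ c _)) (length-++-≤ˡ α) ,
          proj₂ (⟦⟧-update-fresh-under A c hA a ρ _ α) pA) ,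
     (β , proj₂ (⊑-var _ b β c b≢c (update-same ρ c _)) (length-++-≤ʳ β {α}) ,
          proj₂ (⟦⟧-update-fresh-under B c hB b ρ _ β) pB))

pairₜ : Term → Term → Term
pairₜ x y = (x ∘ₜ (c0 ∘ₜ y)) ∘ₜ (x ∘ₜ (c1 ∘ₜ y))

Allₜ-pairₜ : ∀ {S} x y → Allₜ S x → Allₜ S y → Allₜ S (pairₜ x y)
Allₜ-pairₜ x y hx hy = (hx , tt , hy) , (hx , tt , hy)

pairₜ-≐ : ∀ a b c d → (pairₜ a c ≐ pairₜ b d) ≋ ((a ≐ b) ∧ᶠ (c ≐ d))
pairₜ-≐ a b c d = mk≋ λ ρ →
  pair-injective (⟦ a ⟧ₜ ρ) (⟦ c ⟧ₜ ρ) (⟦ b ⟧ₜ ρ) (⟦ d ⟧ₜ ρ) , λ (a≡b , c≡d) → cong₂ pair a≡b c≡d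

Below : (Var → Set) → ℕ → Set
Below R k = ∀ v → R v → v < k

Below-mono : ∀ {R k k′} → Below R k → k ≤ k′ → Below R k′
Below-mono rb k≤k′ v r = <-≤-trans (rb v r) k≤k′

Scope : (Var → Set) → ℕ → ℕ → Var → Set
Scope R k k′ v = R v ⊎ (k ≤ v × v < k′)

Scope-widen : ∀ {R a b a′ b′} → a′ ≤ a → b ≤ b′ → Scope R a b ⊆ Scope R a′ b′
Scope-widen _ _ (inj₁ r) = inj₁ r
Scope-widen a′≤a b≤b′ (inj₂ (a≤v , v<b)) = inj₂ (≤-trans a′≤a a≤v , <-≤-trans v<b b≤b′)

Scope-< : ∀ {R k a b} → Below R k → k ≤ b → Scope R a b ⊆ (_< b)
Scope-< rb k≤b (inj₁ r) = <-≤-trans (rb _ r) k≤b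
Scope-< rb k≤b (inj₂ (_ , v<b)) = v<b

Scope-outside : ∀ {R k a b lo hi} → Below R k → k ≤ lo → b ≤ lo ⊎ hi ≤ a →
  Scope R a b ⊆ (λ v → v < lo ⊎ hi ≤ v)
Scope-outside rb k≤lo _ (inj₁ r) = inj₁ (<-≤-trans (rb _ r) k≤lo)
Scope-outside rb k≤lo (inj₁ b≤lo) (inj₂ (_ , v<b)) = inj₁ (<-≤-trans v<b b≤lo)
Scope-outside rb k≤lo (inj₂ hi≤a) (inj₂ (a≤v , _)) = inj₂ (≤-trans hi≤a a≤v)

Scope-≢ : ∀ {R k a b x} → Below R k → k ≤ x → x < a ⊎ b ≤ x → Scope R a b ⊆ (_≢ x)
Scope-≢ rb k≤x _ (inj₁ r) = <⇒≢ (<-≤-trans (rb _ r) k≤x)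
Scope-≢ rb k≤x (inj₁ x<a) (inj₂ (a≤v , _)) = >⇒≢ (<-≤-trans x<a a≤v)
Scope-≢ rb k≤x (inj₂ b≤x) (inj₂ (_ , v<b)) = <⇒≢ (<-≤-trans v<b b≤x)

-- ∃ k (prefix) lhs = rhs, equivalent to S; its variables are parameters (R, all below k) or
-- lie in [k, k′), and if b holds the prefix is existential.
record Rep (R : Var → Set) (b : Bool) (k k′ : ℕ) (S : Env → Set) : Set where
  field
    prefix : Prefix
    lhs rhs : Term
    window : Window (suc k) k′ prefix
    scopeᵖ : Allᵖ (Scope R k k′) prefix
    scopeˡ : Allₜ (Scope R k k′) lhs
    scopeʳ : Allₜ (Scope R k k′) rhs
    existential : T b → Existential prefix
    correct : ∀ ρ → ⟦ ∃ᶠ k (prefixed prefix (lhs ≐ rhs)) ⟧ ρ ⟺ S ρ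
open Rep public

matrix : ∀ {R b k k′ S} → Rep R b k k′ S → Fm
matrix A = prefixed (prefix A) (lhs A ≐ rhs A)

Allᶠ-matrix : ∀ {R b k k′ S} (A : Rep R b k k′ S) → Allᶠ (Scope R k k′) (matrix A)
Allᶠ-matrix A = Allᶠ-prefixed (prefix A) (lhs A ≐ rhs A) (scopeᵖ A) (scopeˡ A , scopeʳ A)

Rep-< : ∀ {R b k k′ S} (A : Rep R b k k′ S) → k < k′
Rep-< A = Window-≤ (prefix A) (window A)

Rep-cong : ∀ {R b k k′ S S′} → (∀ ρ → S ρ ⟺ S′ ρ) → Rep R b k k′ S → Rep R b k k′ S′
Rep-cong S⟺S′ A = record
  { prefix = prefix A ; lhs = lhs A ; rhs = rhs A ; window = window A
  ; scopeᵖ = scopeᵖ A ; scopeˡ = scopeˡ A ; scopeʳ = scopeʳ A ; existential = existential A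
  ; correct = λ ρ → ⟺-trans (correct A ρ) (S⟺S′ ρ) }

≐-Rep : ∀ {R} k s t → Below R k → Allₜ R s → Allₜ R t →
  Rep R true k (suc k) (λ ρ → ⟦ s ⟧ₜ ρ ≡ ⟦ t ⟧ₜ ρ)
≐-Rep {R} k s t rb hs ht = record
  { prefix = [] ; lhs = s ; rhs = t ; window = ≤-refl ; scopeᵖ = []
  ; scopeˡ = Allₜ-mono inj₁ s hs ; scopeʳ = Allₜ-mono inj₁ t ht ; existential = λ _ → []
  ; correct = at (∃-vacuous (s ≐ t) k (Allₜ-mono fresh s hs , Allₜ-mono fresh t ht)) }
  where
  fresh : R ⊆ (_≢ k)
  fresh r = <⇒≢ (rb _ r)

⊑-Rep : ∀ {R} k s u → Below R k → Allₜ R s → Allₜ R u →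
  Rep R true k (2 + k) (λ ρ → length (⟦ s ⟧ₜ ρ) ≤ length (⟦ u ⟧ₜ ρ))
⊑-Rep {R} k s u rb hs hu = record
  { prefix = (qex , suc k , u) ∷ [] ; lhs = var (suc k) ; rhs = s
  ; window = ≤-refl , Allₜ-mono (λ r → <-trans (rb _ r) (n<1+n k)) u hu , ≤-refl
  ; scopeᵖ = (inj₂ (n≤1+n k , ≤-refl) , Allₜ-mono inj₁ u hu) ∷ []
  ; scopeˡ = inj₂ (n≤1+n k , ≤-refl) ; scopeʳ = Allₜ-mono inj₁ s hs ; existential = λ _ → refl ∷ []
  ; correct = λ ρ → ⟺-trans (at (∃-vacuous (∃⊑ (suc k) u (var (suc k) ≐ s)) k F-fresh) ρ)
                            (∃⊑-≐ ρ (suc k) s u (Allₜ-mono ≢suc s hs) (Allₜ-mono ≢suc u hu)) }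
  where
  ≢k : R ⊆ (_≢ k)
  ≢k r = <⇒≢ (rb _ r)
  ≢suc : R ⊆ (_≢ suc k)
  ≢suc r = <⇒≢ (<-trans (rb _ r) (n<1+n k))
  F-fresh : Allᶠ (_≢ k) (∃⊑ (suc k) u (var (suc k) ≐ s))
  F-fresh = >⇒≢ (n<1+n k) , (>⇒≢ (n<1+n k) , Allₜ-mono ≢k u hu) , >⇒≢ (n<1+n k) , Allₜ-mono ≢k s hs

length-∷ʳ : ∀ (xs : BitString) b → length (xs ++ b ∷ []) ≡ suc (length xs)
length-∷ʳ xs b = trans (length-++ xs) (+-comm (length xs) 1)

<-Rep : ∀ {R} k s u → Below R k → Allₜ R s → Allₜ R u →
  Rep R true k (2 + k) (λ ρ → length (⟦ s ⟧ₜ ρ) < length (⟦ u ⟧ₜ ρ))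
<-Rep k s u rb hs hu = Rep-cong
  (λ ρ → subst (_≤ length (⟦ u ⟧ₜ ρ)) (length-∷ʳ (⟦ s ⟧ₜ ρ) true) ,
         subst (_≤ length (⟦ u ⟧ₜ ρ)) (sym (length-∷ʳ (⟦ s ⟧ₜ ρ) true)))
  (⊑-Rep k (s ∘ₜ c1) u rb (hs , tt) hu)

⋢-Rep : ∀ {R} k s u → Below R k → Allₜ R s → Allₜ R u →
  Rep R true k (2 + k) (λ ρ → ¬ length (⟦ s ⟧ₜ ρ) ≤ length (⟦ u ⟧ₜ ρ))
⋢-Rep k s u rb hs hu = Rep-cong (λ ρ → <⇒≱ , ≰⇒>) (<-Rep k u s rb hu hs)

∧-Rep : ∀ {R b₁ b₂ k k₁ k₂ S₁ S₂} → Below R k → Rep R b₁ (suc k) k₁ S₁ → Rep R b₂ k₁ k₂ S₂ →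
  Rep R (b₁ ∧ b₂) k k₂ (λ ρ → S₁ ρ × S₂ ρ)
∧-Rep {R} {b₁} {b₂} {k} {k₁} {k₂} rb A B = record
  { prefix = QA ++ QB
  ; lhs = pairₜ (lhs A) (lhs B) ; rhs = pairₜ (rhs A) (rhs B)
  ; window = Window-++ QA QB (≤-refl , n<1+n k , window A) (≤-refl , k<k₁ , window B)
  ; scopeᵖ = ++⁺ ((inj₂ (n≤1+n k , sk<k₂) , inj₂ (≤-refl , k<k₂)) ∷ Allᵖ-mono widenA (prefix A) (scopeᵖ A))
                 ((inj₂ (<⇒≤ k<k₁ , Rep-< B) , inj₂ (≤-refl , k<k₂)) ∷ Allᵖ-mono widenB (prefix B) (scopeᵖ B))
  ; scopeˡ = Allₜ-pairₜ (lhs A) (lhs B) (Allₜ-mono widenA (lhs A) (scopeˡ A)) (Allₜ-mono widenB (lhs B) (scopeˡ B))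
  ; scopeʳ = Allₜ-pairₜ (rhs A) (rhs B) (Allₜ-mono widenA (rhs A) (scopeʳ A)) (Allₜ-mono widenB (rhs B) (scopeʳ B))
  ; existential = λ h → let hA , hB = Equivalence.to T-∧ h in
                        ++⁺ (refl ∷ existential A hA) (refl ∷ existential B hB)
  ; correct = λ ρ → ⟺-trans (at equivalent ρ)
      ((λ (a , b) → proj₁ (correct A ρ) a , proj₁ (correct B ρ) b) ,
       (λ (a , b) → proj₂ (correct A ρ) a , proj₂ (correct B ρ) b)) }
  where
  open ≋-Reasoning
  QA QB : Prefix
  QA = (qex , suc k , var k) ∷ prefix A
  QB = (qex , k₁ , var k) ∷ prefix B
  EA EB : Fm
  EA = lhs A ≐ rhs A
  EB = lhs B ≐ rhs B
  k<k₁ : k < k₁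
  k<k₁ = <-trans (n<1+n k) (Rep-< A)
  k<k₂ : k < k₂
  k<k₂ = <-trans k<k₁ (Rep-< B)
  sk<k₂ : suc k < k₂
  sk<k₂ = <-≤-trans (Rep-< A) (<⇒≤ (Rep-< B))
  widenA : Scope R (suc k) k₁ ⊆ Scope R k k₂
  widenA = Scope-widen {R} (n≤1+n k) (<⇒≤ (Rep-< B))
  widenB : Scope R k₁ k₂ ⊆ Scope R k k₂
  widenB = Scope-widen {R} (<⇒≤ k<k₁) ≤-refl
  outside : Scope R k₁ k₂ ⊆ (λ v → v < suc k ⊎ k₁ ≤ v)
  outside = Scope-outside rb (n≤1+n k) (inj₂ ≤-refl)
  B-avoids-QA : Allᶠ (NotBound QA) (prefixed QB EB)
  B-avoids-QA = Allᶠ-mono (Window-NotBound QA (≤-refl , n<1+n k , window A)) (prefixed QB EB)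
    (Allᶠ-prefixed QB EB ((inj₂ ≤-refl , inj₁ (n<1+n k)) ∷ Allᵖ-mono outside (prefix B) (scopeᵖ B))
                         (Allₜ-mono outside (lhs B) (scopeˡ B) , Allₜ-mono outside (rhs B) (scopeʳ B)))
  A-avoids-QB : Allᶠ (NotBound QB) EA
  A-avoids-QB = Allᶠ-mono (λ v<k₁ → Window-NotBound QB (≤-refl , k<k₁ , window B) (inj₁ v<k₁)) EA
    (Allᶠ-mono (Scope-< rb (<⇒≤ k<k₁)) EA (scopeˡ A , scopeʳ A))
  equivalent : ∃ᶠ k (prefixed (QA ++ QB) (pairₜ (lhs A) (lhs B) ≐ pairₜ (rhs A) (rhs B)))
             ≋ (∃ᶠ (suc k) (matrix A) ∧ᶠ ∃ᶠ k₁ (matrix B))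
  equivalent = begin
    ∃ᶠ k (prefixed (QA ++ QB) _)
      ≈⟨ ∃-cong k (prefixed-cong (QA ++ QB) (pairₜ-≐ _ _ _ _)) ⟩
    ∃ᶠ k (prefixed (QA ++ QB) (EA ∧ᶠ EB))
      ≈⟨ ∃-cong k (≋-sym (prefixed-∧-prefixed QA QB EA EB B-avoids-QA A-avoids-QB)) ⟩
    ∃ᶠ k (prefixed QA EA ∧ᶠ prefixed QB EB)
      ≈⟨ ∃-merge k (suc k) k₁ (matrix A) (matrix B) (>⇒≢ (n<1+n k)) (>⇒≢ k<k₁)
           (Allᶠ-mono (Scope-≢ rb ≤-refl (inj₁ (n<1+n k))) (matrix A) (Allᶠ-matrix A))
           (Allᶠ-mono (Scope-≢ rb ≤-refl (inj₁ k<k₁)) (matrix B) (Allᶠ-matrix B)) ⟩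
    ∃ᶠ (suc k) (matrix A) ∧ᶠ ∃ᶠ k₁ (matrix B)
      ∎

-- Guard W S T is the meaning of the guard formula below: when W = 0 the strings P, Q
-- are forced into 0*, so the delimiters 1 pin down S = T; when W = ε anything commutes.
GuardEqs : BitString → BitString → BitString → BitString → BitString → Set
GuardEqs P Q W S T = P ++ W ≡ W ++ P × Q ++ W ≡ W ++ Q × true ∷ (S ++ true ∷ P) ≡ Q ++ true ∷ (T ++ true ∷ [])

Guard : BitString → BitString → BitString → Set
Guard W S T = ∃[ P ] ∃[ Q ] length P ≤ length D × length Q ≤ length D × GuardEqs P Q W S T
  where
  D : BitString
  D = true ∷ (S ++ (T ++ true ∷ []))

Guard-ε : ∀ S T → Guard [] S T
Guard-ε S T = true ∷ (T ++ true ∷ []) , true ∷ (S ++ true ∷ []) ,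
  s≤s (length-++-≤ʳ _ {S}) ,
  s≤s (subst₂ _≤_ (sym (length-++ S)) (sym (length-++ S)) (+-monoʳ-≤ (length S) (length-++-≤ʳ _ {T}))) ,
  ++-identityʳ _ , ++-identityʳ _ , cong (true ∷_) (sym (++-assoc S (true ∷ []) _))

Guard-0 : ∀ S T → Guard (false ∷ []) S T ⟺ (S ≡ T)
Guard-0 S T =
  (λ (P , Q , _ , _ , P0≡0P , Q0≡0Q , eq) →
     delimited-injective S T (commutes-with-0⇒Zeros P P0≡0P) (commutes-with-0⇒Zeros Q Q0≡0Q) eq) ,
  (λ S≡T → [] , [] , z≤n , z≤n , refl , refl , cong (λ X → true ∷ (X ++ true ∷ [])) S≡T)

delim : Term → Term → Term
delim s t = c1 ∘ₜ (s ∘ₜ (t ∘ₜ c1))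

guardPrefix : Var → Var → Term → Term → Prefix
guardPrefix p q s t = (qex , p , delim s t) ∷ (qex , q , delim s t) ∷ []

guardMatrix : Var → Var → Var → Term → Term → Fm
guardMatrix p q w s t = ((var p ∘ₜ var w) ≐ (var w ∘ₜ var p)) ∧ᶠ (((var q ∘ₜ var w) ≐ (var w ∘ₜ var q))
                      ∧ᶠ ((c1 ∘ₜ (s ∘ₜ (c1 ∘ₜ var p))) ≐ (var q ∘ₜ (c1 ∘ₜ (t ∘ₜ c1)))))

guard : Var → Var → Var → Term → Term → Fm
guard p q w s t = prefixed (guardPrefix p q s t) (guardMatrix p q w s t)

guardₗ guardᵣ : Var → Var → Var → Term → Term → Term
guardₗ p q w s t = pairₜ (var p ∘ₜ var w) (pairₜ (var q ∘ₜ var w) (c1 ∘ₜ (s ∘ₜ (c1 ∘ₜ var p))))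
guardᵣ p q w s t = pairₜ (var w ∘ₜ var p) (pairₜ (var w ∘ₜ var q) (var q ∘ₜ (c1 ∘ₜ (t ∘ₜ c1))))

guard-≐ : ∀ p q w s t → (guardₗ p q w s t ≐ guardᵣ p q w s t) ≋ guardMatrix p q w s t
guard-≐ p q w s t = ≋-trans (pairₜ-≐ _ _ _ _) (∧-cong ≋-refl (pairₜ-≐ _ _ _ _))

module _ (p q w : Var) (s t : Term) (p≢q : p ≢ q) (w≢p : w ≢ p) (w≢q : w ≢ q)
         (hs : Allₜ (λ v → v ≢ p × v ≢ q) s) (ht : Allₜ (λ v → v ≢ p × v ≢ q) t) where

  private
    GuardEqs-cong : ∀ {P P′ Q Q′ W W′ S S′ T T′} → P ≡ P′ → Q ≡ Q′ → W ≡ W′ → S ≡ S′ → T ≡ T′ →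
                    GuardEqs P Q W S T ⟺ GuardEqs P′ Q′ W′ S′ T′
    GuardEqs-cong refl refl refl refl refl = (λ b → b) , (λ b → b)

    fresh₁ : ∀ ρ P → Agree (λ v → v ≢ p × v ≢ q) (ρ [ p ↦ P ]) ρ
    fresh₁ ρ P v (v≢p , _) = update-other ρ P v≢p

    fresh₂ : ∀ ρ P Q → Agree (λ v → v ≢ p × v ≢ q) ((ρ [ p ↦ P ]) [ q ↦ Q ]) ρ
    fresh₂ ρ P Q v (v≢p , v≢q) = trans (update-other _ Q v≢q) (update-other ρ P v≢p)

    delim-fresh : Allₜ (λ v → v ≢ p × v ≢ q) (delim s t)
    delim-fresh = tt , hs , ht , tt

    ⟦guardMatrix⟧ : ∀ ρ P Q → ⟦ guardMatrix p q w s t ⟧ ((ρ [ p ↦ P ]) [ q ↦ Q ]) ⟺ GuardEqs P Q (ρ w) (⟦ s ⟧ₜ ρ) (⟦ t ⟧ₜ ρ)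
    ⟦guardMatrix⟧ ρ P Q = GuardEqs-cong (trans (update-other _ Q p≢q) (update-same ρ p P)) (update-same _ q Q)
      (trans (update-other _ Q w≢q) (update-other ρ P w≢p)) (⟦⟧ₜ-agree s hs (fresh₂ ρ P Q)) (⟦⟧ₜ-agree t ht (fresh₂ ρ P Q))

    bound₁ : ∀ ρ P → ⟦ var p ⊑ delim s t ⟧ (ρ [ p ↦ P ]) ⟺ (length P ≤ length (⟦ delim s t ⟧ₜ ρ))
    bound₁ ρ P = ⊑-update ρ p P (delim s t) (Allₜ-mono proj₁ (delim s t) delim-fresh)

    bound₂ : ∀ ρ P Q → ⟦ var q ⊑ delim s t ⟧ ((ρ [ p ↦ P ]) [ q ↦ Q ]) ⟺ (length Q ≤ length (⟦ delim s t ⟧ₜ ρ))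
    bound₂ ρ P Q = ⟺-trans (⊑-update (ρ [ p ↦ P ]) q Q (delim s t) (Allₜ-mono proj₂ (delim s t) delim-fresh))
      (subst (λ D → length Q ≤ length D) (⟦⟧ₜ-agree (delim s t) delim-fresh (fresh₁ ρ P)) ,
       subst (λ D → length Q ≤ length D) (sym (⟦⟧ₜ-agree (delim s t) delim-fresh (fresh₁ ρ P))))

  ⟦guard⟧ : ∀ ρ → ⟦ guard p q w s t ⟧ ρ ⟺ Guard (ρ w) (⟦ s ⟧ₜ ρ) (⟦ t ⟧ₜ ρ)
  ⟦guard⟧ ρ =
    (λ (P , P⊑ , Q , Q⊑ , b) →
       P , Q , proj₁ (bound₁ ρ P) P⊑ , proj₁ (bound₂ ρ P Q) Q⊑ , proj₁ (⟦guardMatrix⟧ ρ P Q) b) ,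
    (λ (P , Q , P⊑ , Q⊑ , b) →
       P , proj₂ (bound₁ ρ P) P⊑ , Q , proj₂ (bound₂ ρ P Q) Q⊑ , proj₂ (⟦guardMatrix⟧ ρ P Q) b)

Allᶠ-guard : ∀ {S : Var → Set} p q w s t → S p → S q → S w → Allₜ S s → Allₜ S t →
  Allᵖ S (guardPrefix p q s t) × Allᶠ S (guardMatrix p q w s t)
Allᶠ-guard p q w s t hp hq hw hs ht =
  (hp , tt , hs , ht , tt) ∷ (hq , tt , hs , ht , tt) ∷ [] ,
  ((hp , hw) , (hw , hp)) , ((hq , hw) , (hw , hq)) , ((tt , hs , tt , hp) , (hq , tt , ht , tt))

Allₜ-guard : ∀ {S : Var → Set} p q w s t → Allᶠ S (guardMatrix p q w s t) →
  Allₜ S (guardₗ p q w s t) × Allₜ S (guardᵣ p q w s t)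
Allₜ-guard p q w s t ((pw , wp) , (qw , wq) , (sp , qt)) =
  Allₜ-pairₜ (var p ∘ₜ var w) (pairₜ (var q ∘ₜ var w) (c1 ∘ₜ (s ∘ₜ (c1 ∘ₜ var p)))) pw
    (Allₜ-pairₜ (var q ∘ₜ var w) (c1 ∘ₜ (s ∘ₜ (c1 ∘ₜ var p))) qw sp) ,
  Allₜ-pairₜ (var w ∘ₜ var p) (pairₜ (var w ∘ₜ var q) (var q ∘ₜ (c1 ∘ₜ (t ∘ₜ c1)))) wp
    (Allₜ-pairₜ (var w ∘ₜ var q) (var q ∘ₜ (c1 ∘ₜ (t ∘ₜ c1))) wq qt)

guardPrefix-Window : ∀ p s t → Allₜ (_< p) s → Allₜ (_< p) t → Window p (2 + p) (guardPrefix p (suc p) s t)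
guardPrefix-Window p s t hs ht =
  ≤-refl , (tt , hs , ht , tt) , ≤-refl , (tt , Allₜ-mono <suc s hs , Allₜ-mono <suc t ht , tt) , ≤-refl
  where
  <suc : (_< p) ⊆ (_< suc p)
  <suc v<p = <-trans v<p (n<1+n p)

-- Disjunction

split-0 : ∀ (x y : BitString) → x ++ y ≡ false ∷ [] → (x ≡ [] × y ≡ false ∷ []) ⊎ (x ≡ false ∷ [] × y ≡ [])
split-0 [] y eq = inj₁ (refl , eq)
split-0 (false ∷ []) [] eq = inj₂ (refl , refl)
split-0 (true ∷ []) [] ()
split-0 (_ ∷ []) (_ ∷ _) ()
split-0 (_ ∷ _ ∷ _) _ ()

-- Since w w′ = 0, exactly one of w, w′ is 0; it switches on its side of the disjunction.
switch : ∀ w w′ X Y X′ Y′ → w ≢ w′ →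
  Allᶠ (λ v → v ≢ w × v ≢ w′) X′ → Allᶠ (λ v → v ≢ w × v ≢ w′) Y′ →
  (∀ ρ → ρ w ≡ false ∷ [] → ⟦ X ⟧ ρ ⟺ ⟦ X′ ⟧ ρ) → (∀ ρ → ρ w ≡ [] → ⟦ X ⟧ ρ) →
  (∀ ρ → ρ w′ ≡ false ∷ [] → ⟦ Y ⟧ ρ ⟺ ⟦ Y′ ⟧ ρ) → (∀ ρ → ρ w′ ≡ [] → ⟦ Y ⟧ ρ) →
  ∃⊑ w c0 (∃⊑ w′ c0 (((var w ∘ₜ var w′) ≐ c0) ∧ᶠ (X ∧ᶠ Y))) ≋ (X′ ∨ᶠ Y′)
switch w w′ X Y X′ Y′ w≢w′ hX′ hY′ X-on X-off Y-on Y-off = mk≋ λ ρ →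
  (λ (ω , _ , ω′ , _ , ww′≡0 , x , y) → case-split ρ ω ω′ x y (split-0 _ _ ww′≡0)) ,
  (λ where
    (inj₁ x′) → false ∷ [] , ⊑0 ρ w (s≤s z≤n) , [] , ⊑0 (ρ [ w ↦ false ∷ [] ]) w′ z≤n ,
                cong₂ _++_ (at-w ρ _ _) (at-w′ ρ _ _) ,
                proj₂ (X-on _ (at-w ρ _ _)) (proj₂ (⟦⟧-agree X′ hX′ (agree ρ _ _)) x′) ,
                Y-off _ (at-w′ ρ _ _)
    (inj₂ y′) → [] , ⊑0 ρ w z≤n , false ∷ [] , ⊑0 (ρ [ w ↦ [] ]) w′ (s≤s z≤n) ,
                cong₂ _++_ (at-w ρ _ _) (at-w′ ρ _ _) ,
                X-off _ (at-w ρ _ _) ,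
                proj₂ (Y-on _ (at-w′ ρ _ _)) (proj₂ (⟦⟧-agree Y′ hY′ (agree ρ _ _)) y′))
  where
  at-w : ∀ ρ ω ω′ → ((ρ [ w ↦ ω ]) [ w′ ↦ ω′ ]) w ≡ ω
  at-w ρ ω ω′ = trans (update-other _ ω′ w≢w′) (update-same ρ w ω)
  at-w′ : ∀ ρ ω ω′ → ((ρ [ w ↦ ω ]) [ w′ ↦ ω′ ]) w′ ≡ ω′
  at-w′ ρ ω ω′ = update-same _ w′ ω′
  agree : ∀ ρ ω ω′ → Agree (λ v → v ≢ w × v ≢ w′) ((ρ [ w ↦ ω ]) [ w′ ↦ ω′ ]) ρ
  agree ρ ω ω′ v (v≢w , v≢w′) = trans (update-other _ ω′ v≢w′) (update-other ρ ω v≢w)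
  ⊑0 : ∀ ρ x {α} → length α ≤ 1 → ⟦ var x ⊑ c0 ⟧ (ρ [ x ↦ α ])
  ⊑0 ρ x l = proj₂ (⊑-update ρ x _ c0 tt) l
  case-split : ∀ ρ ω ω′ → let ρ′ = (ρ [ w ↦ ω ]) [ w′ ↦ ω′ ] in ⟦ X ⟧ ρ′ → ⟦ Y ⟧ ρ′ →
    (ρ′ w ≡ [] × ρ′ w′ ≡ false ∷ []) ⊎ (ρ′ w ≡ false ∷ [] × ρ′ w′ ≡ []) → ⟦ X′ ⟧ ρ ⊎ ⟦ Y′ ⟧ ρ
  case-split ρ ω ω′ x y (inj₁ (_ , w′≡0)) = inj₂ (proj₁ (⟦⟧-agree Y′ hY′ (agree ρ ω ω′)) (proj₁ (Y-on _ w′≡0) y))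
  case-split ρ ω ω′ x y (inj₂ (w≡0 , _)) = inj₁ (proj₁ (⟦⟧-agree X′ hX′ (agree ρ ω ω′)) (proj₁ (X-on _ w≡0) x))

∃-merge-∨ : ∀ c a b A B → a ≢ c → b ≢ c → Allᶠ (_≢ c) A → Allᶠ (_≢ c) B →
  ∃ᶠ c (∃⊑ a (var c) A ∨ᶠ ∃⊑ b (var c) B) ≋ (∃ᶠ a A ∨ᶠ ∃ᶠ b B)
∃-merge-∨ c a b A B a≢c b≢c hA hB = mk≋ λ ρ →
  (λ where
    (γ , inj₁ (α , _ , pA)) → inj₁ (α , proj₁ (⟦⟧-update-fresh-under A c hA a ρ γ α) pA)
    (γ , inj₂ (β , _ , pB)) → inj₂ (β , proj₁ (⟦⟧-update-fresh-under B c hB b ρ γ β) pB)) ,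
  (λ where
    (inj₁ (α , pA)) → α , inj₁ (α , proj₂ (⊑-var _ a α c a≢c (update-same ρ c α)) ≤-refl ,
                                     proj₂ (⟦⟧-update-fresh-under A c hA a ρ α α) pA)
    (inj₂ (β , pB)) → β , inj₂ (β , proj₂ (⊑-var _ b β c b≢c (update-same ρ c β)) ≤-refl ,
                                     proj₂ (⟦⟧-update-fresh-under B c hB b ρ β β) pB))

-- A representation whose matrix only has to hold when the switch variable sw is 0.
module Guarded {R : Var → Set} {b : Bool} {h end : ℕ} {S : Env → Set} (H : Rep R b h end S)
               (c sw : Var) (rb : Below R c) (c<h : c < h) (sw<h : sw < h) where

  guarded guarded′ : Fm
  guarded = ∃⊑ h (var c) (prefixed (prefix H) (guard end (1 + end) sw (lhs H) (rhs H)))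
  guarded′ = ∃⊑ h (var c) (matrix H)

  private
    <end : Scope R h end ⊆ (_< end)
    <end = Scope-< rb (<⇒≤ (<-trans c<h (Rep-< H)))

    fresh : Scope R h end ⊆ (λ v → v ≢ end × v ≢ suc end)
    fresh s = <⇒≢ (<end s) , <⇒≢ (<-trans (<end s) (n<1+n end))

    sw<end : sw < end
    sw<end = <-trans sw<h (Rep-< H)

    ⟦guard⟧H : ∀ ρ → ⟦ guard end (1 + end) sw (lhs H) (rhs H) ⟧ ρ ⟺ Guard (ρ sw) (⟦ lhs H ⟧ₜ ρ) (⟦ rhs H ⟧ₜ ρ)
    ⟦guard⟧H = ⟦guard⟧ end (1 + end) sw (lhs H) (rhs H) (<⇒≢ (n<1+n end)) (<⇒≢ sw<end) (<⇒≢ (<-trans sw<end (n<1+n end)))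
                 (Allₜ-mono fresh (lhs H) (scopeˡ H)) (Allₜ-mono fresh (rhs H) (scopeʳ H))

    sw-free : ∀ u → Allₜ (NotBound ((qex , h , var c) ∷ prefix H)) u →
              Allᶠ (NotBound ((qex , h , var c) ∷ prefix H)) (var sw ≐ u)
    sw-free u hu = Window-NotBound ((qex , h , var c) ∷ prefix H) (≤-refl , c<h , window H) (inj₁ sw<h) , hu

  guarded-on : ∀ ρ → ρ sw ≡ false ∷ [] → ⟦ guarded ⟧ ρ ⟺ ⟦ guarded′ ⟧ ρ
  guarded-on = prefixed-cong-under ((qex , h , var c) ∷ prefix H) (var sw ≐ c0) (sw-free c0 tt)
    λ ρ sw≡0 → ⟺-trans (⟦guard⟧H ρ)
      (subst (λ W → Guard W (⟦ lhs H ⟧ₜ ρ) (⟦ rhs H ⟧ₜ ρ) ⟺ (⟦ lhs H ⟧ₜ ρ ≡ ⟦ rhs H ⟧ₜ ρ)) (sym sw≡0) (Guard-0 _ _))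

  guarded-off : ∀ ρ → ρ sw ≡ [] → ⟦ guarded ⟧ ρ
  guarded-off = prefixed-intro-under ((qex , h , var c) ∷ prefix H) (var sw ≐ e) (sw-free e tt)
    λ ρ sw≡ε → proj₂ (⟦guard⟧H ρ) (subst (λ W → Guard W (⟦ lhs H ⟧ₜ ρ) (⟦ rhs H ⟧ₜ ρ)) (sym sw≡ε) (Guard-ε _ _))

module Disjunction {R : Var → Set} {b₁ b₂ : Bool} {k k₁ k₂ : ℕ} {S₁ S₂ : Env → Set} (rb : Below R k)
                   (A : Rep R b₁ (3 + k) k₁ S₁) (B : Rep R b₂ (2 + k₁) k₂ S₂) where
  private
    c w w′ a b : Var
    c = k
    w = 1 + k
    w′ = 2 + k
    a = 3 + k
    b = 2 + k₁

    sA tA sB tB : Term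
    sA = lhs A
    tA = rhs A
    sB = lhs B
    tB = rhs B

    a<k₁ : a < k₁
    a<k₁ = Rep-< A
    b<k₂ : b < k₂
    b<k₂ = Rep-< B
    k₁<b : k₁ < b
    k₁<b = m≤n+m (suc k₁) 1
    k<a : k < a
    k<a = m≤n+m (suc k) 2
    w<a : w < a
    w<a = n≤1+n (2 + k)
    w′<a : w′ < a
    w′<a = ≤-refl
    a<b : a < b
    a<b = <-trans a<k₁ k₁<b
    k₂<end : k₂ < 2 + k₂
    k₂<end = m≤n+m (suc k₂) 1
    b<end : b < 2 + k₂
    b<end = <-trans b<k₂ k₂<end

    QW QA QB : Prefix
    QW = (qex , w , c0) ∷ (qex , w′ , c0) ∷ []
    QA = (qex , a , var c) ∷ (prefix A ++ guardPrefix k₁ (1 + k₁) sA tA)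
    QB = (qex , b , var c) ∷ (prefix B ++ guardPrefix k₂ (1 + k₂) sB tB)

    EW CA CB X Y X′ Y′ : Fm
    EW = (var w ∘ₜ var w′) ≐ c0
    CA = guardMatrix k₁ (1 + k₁) w sA tA
    CB = guardMatrix k₂ (1 + k₂) w′ sB tB
    X = ∃⊑ a (var c) (prefixed (prefix A) (guard k₁ (1 + k₁) w sA tA))
    Y = ∃⊑ b (var c) (prefixed (prefix B) (guard k₂ (1 + k₂) w′ sB tB))
    X′ = ∃⊑ a (var c) (matrix A)
    Y′ = ∃⊑ b (var c) (matrix B)

    <k₁ : Scope R a k₁ ⊆ (_< k₁)
    <k₁ = Scope-< rb (<⇒≤ (<-trans k<a a<k₁))
    <k₂ : Scope R b k₂ ⊆ (_< k₂)
    <k₂ = Scope-< rb (<⇒≤ (<-trans (<-trans k<a a<b) b<k₂))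

    windowA : Window a b QA
    windowA = ≤-refl , k<a , Window-++ (prefix A) _ (window A)
      (guardPrefix-Window k₁ sA tA (Allₜ-mono <k₁ sA (scopeˡ A)) (Allₜ-mono <k₁ tA (scopeʳ A)))
    windowB : Window b (2 + k₂) QB
    windowB = ≤-refl , <-trans k<a a<b , Window-++ (prefix B) _ (window B)
      (guardPrefix-Window k₂ sB tB (Allₜ-mono <k₂ sB (scopeˡ B)) (Allₜ-mono <k₂ tB (scopeʳ B)))

    EW-avoids : Allᶠ (NotBound (QA ++ QB)) EW
    EW-avoids = (NB w<a , NB w′<a) , tt
      where
      NB : ∀ {v} → v < a → NotBound (QA ++ QB) v
      NB v<a = Window-NotBound (QA ++ QB) (Window-++ QA QB windowA windowB) (inj₁ v<a)

    YB-avoids-QA : Allᶠ (NotBound QA) (prefixed QB CB)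
    YB-avoids-QA = Allᶠ-mono (Window-NotBound QA windowA) (prefixed QB CB)
      (Allᶠ-prefixed QB CB ((inj₂ ≤-refl , inj₁ k<a) ∷ ++⁺ (Allᵖ-mono outside (prefix B) (scopeᵖ B)) (proj₁ guards))
                           (proj₂ guards))
      where
      outside : Scope R b k₂ ⊆ (λ v → v < a ⊎ b ≤ v)
      outside = Scope-outside rb (<⇒≤ k<a) (inj₂ ≤-refl)
      after : ∀ {v} → k₂ ≤ v → v < a ⊎ b ≤ v
      after k₂≤v = inj₂ (≤-trans (<⇒≤ b<k₂) k₂≤v)
      guards : Allᵖ (λ v → v < a ⊎ b ≤ v) (guardPrefix k₂ (1 + k₂) sB tB)
             × Allᶠ (λ v → v < a ⊎ b ≤ v) (guardMatrix k₂ (1 + k₂) w′ sB tB)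
      guards = Allᶠ-guard k₂ (1 + k₂) w′ sB tB (after ≤-refl) (after (n≤1+n k₂)) (inj₁ w′<a)
                 (Allₜ-mono outside sB (scopeˡ B)) (Allₜ-mono outside tB (scopeʳ B))

    CA-avoids-QB : Allᶠ (NotBound QB) CA
    CA-avoids-QB = Allᶠ-mono (λ v<b → Window-NotBound QB windowB (inj₁ v<b)) CA
      (proj₂ (Allᶠ-guard k₁ (1 + k₁) w sA tA k₁<b ≤-refl (<-trans w<a a<b)
                (Allₜ-mono <b sA (scopeˡ A)) (Allₜ-mono <b tA (scopeʳ A))))
      where
      <b : Scope R a k₁ ⊆ (_< b)
      <b h = <-trans (<k₁ h) k₁<b

    lhs∨ rhs∨ : Term
    lhs∨ = pairₜ (var w ∘ₜ var w′) (pairₜ (guardₗ k₁ (1 + k₁) w sA tA) (guardₗ k₂ (1 + k₂) w′ sB tB))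
    rhs∨ = pairₜ c0 (pairₜ (guardᵣ k₁ (1 + k₁) w sA tA) (guardᵣ k₂ (1 + k₂) w′ sB tB))

    M-≋ : (lhs∨ ≐ rhs∨) ≋ (EW ∧ᶠ (CA ∧ᶠ CB))
    M-≋ = ≋-trans (pairₜ-≐ _ _ _ _)
            (∧-cong ≋-refl (≋-trans (pairₜ-≐ _ _ _ _) (∧-cong (guard-≐ _ _ _ _ _) (guard-≐ _ _ _ _ _))))

    prefixed-∨ : prefixed (QW ++ (QA ++ QB)) (lhs∨ ≐ rhs∨) ≋ prefixed QW (EW ∧ᶠ (X ∧ᶠ Y))
    prefixed-∨ = begin
      prefixed (QW ++ (QA ++ QB)) (lhs∨ ≐ rhs∨)               ≡⟨ prefixed-++ QW (QA ++ QB) _ ⟩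
      prefixed QW (prefixed (QA ++ QB) (lhs∨ ≐ rhs∨))          ≈⟨ prefixed-cong QW (prefixed-cong (QA ++ QB) M-≋) ⟩
      prefixed QW (prefixed (QA ++ QB) (EW ∧ᶠ (CA ∧ᶠ CB)))     ≈⟨ prefixed-cong QW EW-out ⟩
      prefixed QW (EW ∧ᶠ prefixed (QA ++ QB) (CA ∧ᶠ CB))       ≈⟨ prefixed-cong QW (∧-cong ≋-refl (≋-sym
                                                                    (prefixed-∧-prefixed QA QB CA CB YB-avoids-QA CA-avoids-QB))) ⟩
      prefixed QW (EW ∧ᶠ (prefixed QA CA ∧ᶠ prefixed QB CB))   ≡⟨ cong₂ (λ x y → prefixed QW (EW ∧ᶠ (x ∧ᶠ y)))
                                                                    (cong (∃⊑ a (var c)) (prefixed-++ (prefix A) _ CA))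
                                                                    (cong (∃⊑ b (var c)) (prefixed-++ (prefix B) _ CB)) ⟩
      prefixed QW (EW ∧ᶠ (X ∧ᶠ Y))                             ∎
      where
      open ≋-Reasoning
      EW-out : prefixed (QA ++ QB) (EW ∧ᶠ (CA ∧ᶠ CB)) ≋ (EW ∧ᶠ prefixed (QA ++ QB) (CA ∧ᶠ CB))
      EW-out = ≋-trans (prefixed-cong (QA ++ QB) ∧-comm) (≋-trans (≋-sym (∧-prefixed (QA ++ QB) EW EW-avoids)) ∧-comm)


    module GA = Guarded A c w rb k<a w<a
    module GB = Guarded B c w′ rb (<-trans k<a a<b) (<-trans w′<a a<b)

    avoids-switch : ∀ {h end} → w′ < h → Scope R h end ⊆ (λ v → v ≢ w × v ≢ w′)
    avoids-switch w′<h s = Scope-≢ rb (n≤1+n k) (inj₁ (<-trans (n<1+n w) w′<h)) s , Scope-≢ rb (m≤n+m k 2) (inj₁ w′<h) s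

    c-avoids : c ≢ w × c ≢ w′
    c-avoids = <⇒≢ (n<1+n k) , <⇒≢ (m≤n+m (suc k) 1)

    X′-avoids : Allᶠ (λ v → v ≢ w × v ≢ w′) X′
    X′-avoids = a-avoids , (a-avoids , c-avoids) , Allᶠ-mono (avoids-switch w′<a) (matrix A) (Allᶠ-matrix A)
      where
      a-avoids : a ≢ w × a ≢ w′
      a-avoids = >⇒≢ w<a , >⇒≢ w′<a

    Y′-avoids : Allᶠ (λ v → v ≢ w × v ≢ w′) Y′
    Y′-avoids = b-avoids , (b-avoids , c-avoids) , Allᶠ-mono (avoids-switch (<-trans w′<a a<b)) (matrix B) (Allᶠ-matrix B)
      where
      b-avoids : b ≢ w × b ≢ w′
      b-avoids = >⇒≢ (<-trans w<a a<b) , >⇒≢ (<-trans w′<a a<b)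

    equivalent : ∃ᶠ c (prefixed (QW ++ (QA ++ QB)) (lhs∨ ≐ rhs∨)) ≋ (∃ᶠ a (matrix A) ∨ᶠ ∃ᶠ b (matrix B))
    equivalent = ≋-trans
      (∃-cong c (≋-trans prefixed-∨
        (switch w w′ X Y X′ Y′ (<⇒≢ (n<1+n w)) X′-avoids Y′-avoids
                GA.guarded-on GA.guarded-off GB.guarded-on GB.guarded-off)))
      (∃-merge-∨ c a b (matrix A) (matrix B) (>⇒≢ k<a) (>⇒≢ (<-trans k<a a<b))
        (Allᶠ-mono (Scope-≢ rb ≤-refl (inj₁ k<a)) (matrix A) (Allᶠ-matrix A))
        (Allᶠ-mono (Scope-≢ rb ≤-refl (inj₁ (<-trans k<a a<b))) (matrix B) (Allᶠ-matrix B)))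

    inside : ∀ {v} → k ≤ v → v < 2 + k₂ → Scope R k (2 + k₂) v
    inside k≤v v<end = inj₂ (k≤v , v<end)

    k≤ : ∀ n → k ≤ n + k
    k≤ n = m≤n+m k n

    k≤k₁ : k ≤ k₁
    k≤k₁ = <⇒≤ (<-trans k<a a<k₁)

    k≤k₂ : k ≤ k₂
    k≤k₂ = <⇒≤ (<-trans (<-trans k<a a<b) b<k₂)

    widenA : Scope R a k₁ ⊆ Scope R k (2 + k₂)
    widenA = Scope-widen {R} (k≤ 3) (<⇒≤ (<-trans (<-trans k₁<b b<k₂) k₂<end))

    widenB : Scope R b k₂ ⊆ Scope R k (2 + k₂)
    widenB = Scope-widen {R} (<⇒≤ (<-trans k<a a<b)) (<⇒≤ k₂<end)

    a<end : a < 2 + k₂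
    a<end = <-trans a<b b<end
    w<end : w < 2 + k₂
    w<end = <-trans w<a a<end

    guardsA : Allᵖ (Scope R k (2 + k₂)) (guardPrefix k₁ (1 + k₁) sA tA)
            × Allᶠ (Scope R k (2 + k₂)) (guardMatrix k₁ (1 + k₁) w sA tA)
    guardsA = Allᶠ-guard k₁ (1 + k₁) w sA tA
      (inside k≤k₁ (<-trans (<-trans k₁<b b<k₂) k₂<end)) (inside (≤-trans k≤k₁ (n≤1+n k₁)) (<-trans (n<1+n (suc k₁)) b<end))
      (inside (k≤ 1) (<-trans (<-trans w<a a<b) b<end)) (Allₜ-mono widenA sA (scopeˡ A)) (Allₜ-mono widenA tA (scopeʳ A))

    guardsB : Allᵖ (Scope R k (2 + k₂)) (guardPrefix k₂ (1 + k₂) sB tB)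
            × Allᶠ (Scope R k (2 + k₂)) (guardMatrix k₂ (1 + k₂) w′ sB tB)
    guardsB = Allᶠ-guard k₂ (1 + k₂) w′ sB tB
      (inside k≤k₂ k₂<end) (inside (≤-trans k≤k₂ (n≤1+n k₂)) (n<1+n (suc k₂)))
      (inside (k≤ 2) (<-trans (<-trans w′<a a<b) b<end)) (Allₜ-mono widenB sB (scopeˡ B)) (Allₜ-mono widenB tB (scopeʳ B))

    termsA : Allₜ (Scope R k (2 + k₂)) (guardₗ k₁ (1 + k₁) w sA tA) × Allₜ (Scope R k (2 + k₂)) (guardᵣ k₁ (1 + k₁) w sA tA)
    termsA = Allₜ-guard k₁ (1 + k₁) w sA tA (proj₂ guardsA)
    termsB : Allₜ (Scope R k (2 + k₂)) (guardₗ k₂ (1 + k₂) w′ sB tB) × Allₜ (Scope R k (2 + k₂)) (guardᵣ k₂ (1 + k₂) w′ sB tB)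
    termsB = Allₜ-guard k₂ (1 + k₂) w′ sB tB (proj₂ guardsB)

  rep : Rep R (b₁ ∧ b₂) k (2 + k₂) (λ ρ → S₁ ρ ⊎ S₂ ρ)
  rep = record
    { prefix = QW ++ (QA ++ QB) ; lhs = lhs∨ ; rhs = rhs∨
    ; window = ≤-refl , tt , ≤-refl , tt , Window-++ QA QB windowA windowB
    ; scopeᵖ = (inside (k≤ 1) w<end , tt) ∷ (inside (k≤ 2) (<-trans w′<a a<end) , tt) ∷
               ++⁺ ((inside (k≤ 3) a<end , inside ≤-refl (<-trans k<a a<end)) ∷
                      ++⁺ (Allᵖ-mono widenA (prefix A) (scopeᵖ A)) (proj₁ guardsA))
                   ((inside (<⇒≤ (<-trans k<a a<b)) b<end , inside ≤-refl (<-trans k<a a<end)) ∷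
                      ++⁺ (Allᵖ-mono widenB (prefix B) (scopeᵖ B)) (proj₁ guardsB))
    ; scopeˡ = Allₜ-pairₜ (var w ∘ₜ var w′) (pairₜ (guardₗ k₁ (1 + k₁) w sA tA) (guardₗ k₂ (1 + k₂) w′ sB tB))
                 (inside (k≤ 1) w<end , inside (k≤ 2) (<-trans w′<a a<end))
                 (Allₜ-pairₜ (guardₗ k₁ (1 + k₁) w sA tA) (guardₗ k₂ (1 + k₂) w′ sB tB) (proj₁ termsA) (proj₁ termsB))
    ; scopeʳ = Allₜ-pairₜ c0 (pairₜ (guardᵣ k₁ (1 + k₁) w sA tA) (guardᵣ k₂ (1 + k₂) w′ sB tB)) tt
                 (Allₜ-pairₜ (guardᵣ k₁ (1 + k₁) w sA tA) (guardᵣ k₂ (1 + k₂) w′ sB tB) (proj₂ termsA) (proj₂ termsB))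
    ; existential = λ h → let hA , hB = Equivalence.to T-∧ h in
        refl ∷ refl ∷ ++⁺ (refl ∷ ++⁺ (existential A hA) (refl ∷ refl ∷ []))
                          (refl ∷ ++⁺ (existential B hB) (refl ∷ refl ∷ []))
    ; correct = λ ρ → ⟺-trans (at equivalent ρ)
        (Sum.map (proj₁ (correct A ρ)) (proj₁ (correct B ρ)) ,
         Sum.map (proj₂ (correct A ρ)) (proj₂ (correct B ρ))) }

∨-Rep : ∀ {R b₁ b₂ k k₁ k₂ S₁ S₂} → Below R k → Rep R b₁ (3 + k) k₁ S₁ → Rep R b₂ (2 + k₁) k₂ S₂ →
  Rep R (b₁ ∧ b₂) k (2 + k₂) (λ ρ → S₁ ρ ⊎ S₂ ρ)
∨-Rep rb A B = Disjunction.rep rb A B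

-- Quantifiers

Below-∪ : ∀ {R k} → Below R k → Below (R ∪ ｛ suc k ｝) (2 + k)
Below-∪ rb v (inj₁ r) = <-trans (rb v r) (m≤n+m (suc _) 1)
Below-∪ rb v (inj₂ refl) = n<1+n _

-- A represents the body with the quantified variable renamed to x = 1 + k; its head
-- variable a = 2 + k is bounded by the new head k, which bounds x as well when needed.
module Quantifier {R : Var → Set} {b : Bool} {k k₁ : ℕ} {S : Env → Set} (rb : Below R k)
                  (A : Rep (R ∪ ｛ suc k ｝) b (2 + k) k₁ S) where

  x a : Var
  x = 1 + k
  a = 2 + k

  private
    k<a : k < a
    k<a = m≤n+m (suc k) 1

    a<k₁ : a < k₁
    a<k₁ = Rep-< A

    R<x : R ⊆ (_< x)
    R<x r = <-trans (rb _ r) (n<1+n k)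

    narrow : Scope (R ∪ ｛ x ｝) a k₁ ⊆ Scope R k k₁
    narrow (inj₁ (inj₁ r)) = inj₁ r
    narrow (inj₁ (inj₂ refl)) = inj₂ (n≤1+n k , <-trans (n<1+n x) a<k₁)
    narrow (inj₂ (a≤v , v<k₁)) = inj₂ (≤-trans (<⇒≤ k<a) a≤v , v<k₁)

    ≢k : Scope (R ∪ ｛ x ｝) a k₁ ⊆ (_≢ k)
    ≢k (inj₁ (inj₁ r)) = <⇒≢ (rb _ r)
    ≢k (inj₁ (inj₂ refl)) = >⇒≢ (n<1+n k)
    ≢k (inj₂ (a≤v , _)) = >⇒≢ (<-≤-trans k<a a≤v)

    ignore-k : ∀ ρ γ α β →
      ⟦ matrix A ⟧ (((ρ [ k ↦ γ ]) [ x ↦ α ]) [ a ↦ β ]) ⟺ ⟦ matrix A ⟧ ((ρ [ x ↦ α ]) [ a ↦ β ])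
    ignore-k ρ γ α β = ⟦⟧-agree (matrix A) (Allᶠ-mono ≢k (matrix A) (Allᶠ-matrix A))
                         (Agree-update (Agree-update (update-agree ρ k γ) x α) a β)

    inner : ∀ ρ γ α → ⟦ ∃⊑ a (var k) (matrix A) ⟧ ((ρ [ k ↦ γ ]) [ x ↦ α ])
                      ⟺ (∃[ β ] length β ≤ length γ × ⟦ matrix A ⟧ ((ρ [ x ↦ α ]) [ a ↦ β ]))
    inner ρ γ α =
      (λ (β , β⊑ , p) → β , proj₁ (bound β) β⊑ , proj₁ (ignore-k ρ γ α β) p) ,
      (λ (β , β⊑ , p) → β , proj₂ (bound β) β⊑ , proj₂ (ignore-k ρ γ α β) p)
      where
      bound : ∀ β → ⟦ var a ⊑ var k ⟧ (((ρ [ k ↦ γ ]) [ x ↦ α ]) [ a ↦ β ]) ⟺ (length β ≤ length γ)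
      bound β = ⊑-var ((ρ [ k ↦ γ ]) [ x ↦ α ]) a β k (>⇒≢ k<a)
                      (trans (update-other _ α (<⇒≢ (n<1+n k))) (update-same ρ k γ))

    outer : ∀ u → Allₜ R u → ∀ ρ γ α →
      ⟦ var x ⊑ u ⟧ ((ρ [ k ↦ γ ]) [ x ↦ α ]) ⟺ (length α ≤ length (⟦ u ⟧ₜ ρ))
    outer u hu ρ γ α = ⟺-trans (⊑-update (ρ [ k ↦ γ ]) x α u (Allₜ-mono (λ r → <⇒≢ (R<x r)) u hu))
      (subst (λ U → length α ≤ length U) u-fresh , subst (λ U → length α ≤ length U) (sym u-fresh))
      where
      u-fresh : ⟦ u ⟧ₜ (ρ [ k ↦ γ ]) ≡ ⟦ u ⟧ₜ ρ
      u-fresh = ⟦⟧ₜ-update-fresh ρ k γ u (Allₜ-mono (λ r → <⇒≢ (rb _ r)) u hu)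

    S⟺ : ∀ ρ α → S (ρ [ x ↦ α ]) ⟺ (∃[ β ] ⟦ matrix A ⟧ ((ρ [ x ↦ α ]) [ a ↦ β ]))
    S⟺ ρ α = ⟺-sym (correct A (ρ [ x ↦ α ]))

    quantified : ∀ {b′ S′} q u → Allₜ (_< x) u → Allₜ (Scope R k k₁) u → (T b′ → q ≡ qex × T b) →
      (∀ ρ → ⟦ ∃ᶠ k (bounded q x u (∃⊑ a (var k) (matrix A))) ⟧ ρ ⟺ S′ ρ) → Rep R b′ k k₁ S′
    quantified q u u<x hu ex sem = record
      { prefix = (q , x , u) ∷ (qex , a , var k) ∷ prefix A ; lhs = lhs A ; rhs = rhs A
      ; window = ≤-refl , u<x , ≤-refl , k<a , window A
      ; scopeᵖ = (inj₂ (n≤1+n k , <-trans (n<1+n x) a<k₁) , hu)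
                 ∷ (inj₂ (<⇒≤ k<a , a<k₁) , inj₂ (≤-refl , <-trans k<a a<k₁))
                 ∷ Allᵖ-mono narrow (prefix A) (scopeᵖ A)
      ; scopeˡ = Allₜ-mono narrow (lhs A) (scopeˡ A) ; scopeʳ = Allₜ-mono narrow (rhs A) (scopeʳ A)
      ; existential = λ h → let q≡qex , hA = ex h in q≡qex ∷ refl ∷ existential A hA
      ; correct = sem }

  ∃⊑-Rep : ∀ u → Allₜ R u → Rep R b k k₁ (λ ρ → ∃[ α ] length α ≤ length (⟦ u ⟧ₜ ρ) × S (ρ [ x ↦ α ]))
  ∃⊑-Rep u hu = quantified qex u (Allₜ-mono R<x u hu) (Allₜ-mono inj₁ u hu)
    (λ h → refl , h) λ ρ →
      (λ (γ , α , α⊑ , p) → let β , _ , q = proj₁ (inner ρ γ α) p in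
         α , proj₁ (outer u hu ρ γ α) α⊑ , proj₂ (S⟺ ρ α) (β , q)) ,
      (λ (α , α⊑ , s) → let β , q = proj₁ (S⟺ ρ α) s in
         β , α , proj₂ (outer u hu ρ β α) α⊑ , proj₂ (inner ρ β α) (β , ≤-refl , q))

  ∃-Rep : Rep R b k k₁ (λ ρ → ∃[ α ] S (ρ [ x ↦ α ]))
  ∃-Rep = quantified qex (var k) (n<1+n k) (inj₂ (≤-refl , <-trans k<a a<k₁)) (λ h → refl , h) λ ρ →
      (λ (γ , α , _ , p) → let β , _ , q = proj₁ (inner ρ γ α) p in α , proj₂ (S⟺ ρ α) (β , q)) ,
      (λ (α , s) → let β , q = proj₁ (S⟺ ρ α) s in
         α ++ β , α , proj₂ (⊑-var (ρ [ k ↦ α ++ β ]) x α k (>⇒≢ (n<1+n k)) (update-same ρ k _)) (length-++-≤ˡ α) ,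
         proj₂ (inner ρ (α ++ β) α) (β , length-++-≤ʳ β {α} , q))

  -- The witnesses for the inner existential are collected below a common bound 0ᴹ.
  ∀⊑-Rep : ∀ u → Allₜ R u → Rep R false k k₁ (λ ρ → ∀ α → length α ≤ length (⟦ u ⟧ₜ ρ) → S (ρ [ x ↦ α ]))
  ∀⊑-Rep u hu = quantified qall u (Allₜ-mono R<x u hu) (Allₜ-mono inj₁ u hu)
    (λ ()) λ ρ →
      (λ (γ , f) α α⊑ → let β , _ , q = proj₁ (inner ρ γ α) (f α (proj₂ (outer u hu ρ γ α) α⊑)) in
         proj₂ (S⟺ ρ α) (β , q)) ,
      (λ g → let M , bounded-witness = collection _ (λ α α⊑ → proj₁ (S⟺ ρ α) (g α α⊑)) in
         replicate M false , λ α α⊑ → let β , β≤M , q = bounded-witness α (proj₁ (outer u hu ρ _ α) α⊑) in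
           proj₂ (inner ρ _ α) (β , subst (length β ≤_) (sym (length-replicate M)) β≤M , q))

-- Inequality

Forks-lengths : ∀ {xs ys p q r} → Forks xs ys p q r →
  length p ≤ length xs × length q ≤ length xs × length r ≤ length ys
Forks-lengths {p = p} {q} {r} (refl , refl) =
  length-++-≤ˡ p , ≤-trans (n≤1+n _) (length-++-≤ʳ (false ∷ q) {p}) , ≤-trans (n≤1+n _) (length-++-≤ʳ (true ∷ r) {p})

Forks⊎-lengths : ∀ xs ys {p q r} → Forks xs ys p q r ⊎ Forks ys xs p q r →
  length p ≤ length (xs ++ ys) × length q ≤ length (xs ++ ys) × length r ≤ length (xs ++ ys)
Forks⊎-lengths xs ys (inj₁ f) = let p≤ , q≤ , r≤ = Forks-lengths f in
  ≤-trans p≤ (length-++-≤ˡ xs) , ≤-trans q≤ (length-++-≤ˡ xs) , ≤-trans r≤ (length-++-≤ʳ ys {xs})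
Forks⊎-lengths xs ys (inj₂ f) = let p≤ , q≤ , r≤ = Forks-lengths f in
  ≤-trans p≤ (length-++-≤ʳ ys {xs}) , ≤-trans q≤ (length-++-≤ʳ ys {xs}) , ≤-trans r≤ (length-++-≤ˡ xs)

Forks⊎-cong : ∀ {xs xs′ ys ys′ p p′ q q′ r r′} → xs ≡ xs′ → ys ≡ ys′ → p ≡ p′ → q ≡ q′ → r ≡ r′ →
  Forks xs ys p q r ⊎ Forks ys xs p q r → Forks xs′ ys′ p′ q′ r′ ⊎ Forks ys′ xs′ p′ q′ r′
Forks⊎-cong refl refl refl refl refl f = f

Agree-update-fresh : ∀ {S ρ ρ′} x a → S ⊆ (_≢ x) → Agree S ρ ρ′ → Agree S (ρ [ x ↦ a ]) ρ′
Agree-update-fresh x a fresh ag v sv = trans (update-other _ a (fresh sv)) (ag v sv)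

module Forking {R : Var → Set} (m : ℕ) (s t : Term) (rb : Below R m) (hs : Allₜ R s) (ht : Allₜ R t) where
  private
    P Q′ R′ : Var
    P = 1 + m
    Q′ = 3 + m
    R′ = 5 + m

    R₁ R₂ R₃ : Var → Set
    R₁ = R ∪ ｛ P ｝
    R₂ = R₁ ∪ ｛ Q′ ｝
    R₃ = R₂ ∪ ｛ R′ ｝

    rb₃ : Below R₃ (6 + m)
    rb₃ = Below-∪ (Below-∪ (Below-∪ rb))

    lift : ∀ u → Allₜ R u → Allₜ R₃ u
    lift = Allₜ-mono (λ r → inj₁ (inj₁ (inj₁ r)))

    p0q p1r : Term
    p0q = var P ∘ₜ (c0 ∘ₜ var Q′)
    p1r = var P ∘ₜ (c1 ∘ₜ var R′)

    p0q-scope : Allₜ R₃ p0q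
    p0q-scope = inj₁ (inj₁ (inj₂ refl)) , tt , inj₁ (inj₂ refl)

    p1r-scope : Allₜ R₃ p1r
    p1r-scope = inj₁ (inj₁ (inj₂ refl)) , tt , inj₂ refl

    Forked : Env → Set
    Forked ρ = Forks (⟦ s ⟧ₜ ρ) (⟦ t ⟧ₜ ρ) (ρ P) (ρ Q′) (ρ R′) ⊎ Forks (⟦ t ⟧ₜ ρ) (⟦ s ⟧ₜ ρ) (ρ P) (ρ Q′) (ρ R′)

    Some⊑ : Var → (Env → Set) → Env → Set
    Some⊑ x S ρ = ∃[ α ] length α ≤ length (⟦ s ∘ₜ t ⟧ₜ ρ) × S (ρ [ x ↦ α ])

    forks : Rep R₃ true (6 + m) (19 + m) Forked
    forks = ∨-Rep rb₃
      (∧-Rep (Below-mono rb₃ (m≤n+m _ 3)) (≐-Rep (10 + m) s p0q (Below-mono rb₃ (m≤n+m _ 4)) (lift s hs) p0q-scope)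
                                          (≐-Rep (11 + m) t p1r (Below-mono rb₃ (m≤n+m _ 5)) (lift t ht) p1r-scope))
      (∧-Rep (Below-mono rb₃ (m≤n+m _ 8)) (≐-Rep (15 + m) t p0q (Below-mono rb₃ (m≤n+m _ 9)) (lift t ht) p0q-scope)
                                          (≐-Rep (16 + m) s p1r (Below-mono rb₃ (m≤n+m _ 10)) (lift s hs) p1r-scope))

    bounded-forks : Rep R true m (19 + m) (Some⊑ P (Some⊑ Q′ (Some⊑ R′ Forked)))
    bounded-forks = Quantifier.∃⊑-Rep rb (Quantifier.∃⊑-Rep (Below-∪ rb)
                      (Quantifier.∃⊑-Rep (Below-∪ (Below-∪ rb)) forks (s ∘ₜ t) (lift₂ s hs , lift₂ t ht))
                      (s ∘ₜ t) (lift₁ s hs , lift₁ t ht)) (s ∘ₜ t) (hs , ht)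
      where
      lift₁ : ∀ u → Allₜ R u → Allₜ R₁ u
      lift₁ = Allₜ-mono inj₁
      lift₂ : ∀ u → Allₜ R u → Allₜ R₂ u
      lift₂ = Allₜ-mono (λ r → inj₁ (inj₁ r))

    fresh : ∀ n → R ⊆ (_≢ suc (n + m))
    fresh n r = <⇒≢ (<-≤-trans (rb _ r) (m≤n+m m (suc n)))

    agree₁ : ∀ ρ α → Agree R (ρ [ P ↦ α ]) ρ
    agree₁ ρ α = Agree-update-fresh P α (fresh 0) (λ _ _ → refl)

    agree₂ : ∀ ρ α β → Agree R ((ρ [ P ↦ α ]) [ Q′ ↦ β ]) ρ
    agree₂ ρ α β = Agree-update-fresh Q′ β (fresh 2) (agree₁ ρ α)

    agree₃ : ∀ ρ α β γ → Agree R (((ρ [ P ↦ α ]) [ Q′ ↦ β ]) [ R′ ↦ γ ]) ρ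
    agree₃ ρ α β γ = Agree-update-fresh R′ γ (fresh 4) (agree₂ ρ α β)

    at-P : ∀ ρ α β γ → (((ρ [ P ↦ α ]) [ Q′ ↦ β ]) [ R′ ↦ γ ]) P ≡ α
    at-P ρ α β γ = trans (update-other _ γ (<⇒≢ (m≤n+m (2 + m) 3)))
                     (trans (update-other _ β (<⇒≢ (m≤n+m (2 + m) 1))) (update-same ρ P α))

    at-Q : ∀ ρ α β γ → (((ρ [ P ↦ α ]) [ Q′ ↦ β ]) [ R′ ↦ γ ]) Q′ ≡ β
    at-Q ρ α β γ = trans (update-other _ γ (<⇒≢ (m≤n+m (4 + m) 1))) (update-same _ Q′ β)

    st≡ : ∀ {ρ ρ′} → Agree R ρ′ ρ → ⟦ s ∘ₜ t ⟧ₜ ρ′ ≡ ⟦ s ∘ₜ t ⟧ₜ ρ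
    st≡ ag = ⟦⟧ₜ-agree (s ∘ₜ t) (hs , ht) ag

  diverge : Rep R true m (19 + m) (λ ρ → Diverge (⟦ s ⟧ₜ ρ) (⟦ t ⟧ₜ ρ))
  diverge = Rep-cong
    (λ ρ → (λ (α , _ , β , _ , γ , _ , f) →
              α , β , γ , Forks⊎-cong (⟦⟧ₜ-agree s hs (agree₃ ρ α β γ)) (⟦⟧ₜ-agree t ht (agree₃ ρ α β γ))
                                      (at-P ρ α β γ) (at-Q ρ α β γ) (update-same _ R′ γ) f) ,
           (λ (p , q , r , f) → let p≤ , q≤ , r≤ = Forks⊎-lengths _ _ f in
              p , p≤ , q , subst (λ u → length q ≤ length u) (sym (st≡ (agree₁ ρ p))) q≤ ,
              r , subst (λ u → length r ≤ length u) (sym (st≡ (agree₂ ρ p q))) r≤ ,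
              Forks⊎-cong (sym (⟦⟧ₜ-agree s hs (agree₃ ρ p q r))) (sym (⟦⟧ₜ-agree t ht (agree₃ ρ p q r)))
                          (sym (at-P ρ p q r)) (sym (at-Q ρ p q r)) (sym (update-same _ R′ r)) f))
    bounded-forks

≢-Rep : ∀ {R} k s t → Below R k → Allₜ R s → Allₜ R t →
  Rep R true k (37 + k) (λ ρ → ⟦ s ⟧ₜ ρ ≢ ⟦ t ⟧ₜ ρ)
≢-Rep k s t rb hs ht = Rep-cong (λ ρ → Differ⇒≢ _ _ , ≢⇒Differ _ _)
  (∨-Rep rb (<-Rep (3 + k) t s (Below-mono rb (m≤n+m k 3)) ht hs)
    (∨-Rep (Below-mono rb (m≤n+m k 7)) (<-Rep (10 + k) s t (Below-mono rb (m≤n+m k 10)) hs ht)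
      (Forking.diverge (14 + k) s t (Below-mono rb (m≤n+m k 14)) hs ht)))

rename : (Var → Var) → Term → Term
rename σ (var x) = var (σ x)
rename σ e = e
rename σ c0 = c0
rename σ c1 = c1
rename σ (s ∘ₜ t) = rename σ s ∘ₜ rename σ t

⟦⟧ₜ-rename : ∀ σ t ρ → ⟦ rename σ t ⟧ₜ ρ ≡ ⟦ t ⟧ₜ (ρ ∘ σ)
⟦⟧ₜ-rename σ (var x) ρ = refl
⟦⟧ₜ-rename σ e ρ = refl
⟦⟧ₜ-rename σ c0 ρ = refl
⟦⟧ₜ-rename σ c1 ρ = refl
⟦⟧ₜ-rename σ (s ∘ₜ t) ρ = cong₂ _++_ (⟦⟧ₜ-rename σ s ρ) (⟦⟧ₜ-rename σ t ρ)

Allₜ-rename : ∀ {R : Var → Set} σ t → (∀ y → R (σ y)) → Allₜ R (rename σ t)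
Allₜ-rename σ (var x) h = h x
Allₜ-rename σ e h = tt
Allₜ-rename σ c0 h = tt
Allₜ-rename σ c1 h = tt
Allₜ-rename σ (s ∘ₜ t) h = Allₜ-rename σ s h , Allₜ-rename σ t h

⟦⟧-rename-≐ : ∀ σ s t ρ → (⟦ rename σ s ⟧ₜ ρ ≡ ⟦ rename σ t ⟧ₜ ρ) ⟺ ⟦ s ≐ t ⟧ (ρ ∘ σ)
⟦⟧-rename-≐ σ s t ρ rewrite ⟦⟧ₜ-rename σ s ρ | ⟦⟧ₜ-rename σ t ρ = (λ p → p) , (λ p → p)

⟦⟧-rename-⊑ : ∀ σ s t ρ →
  (length (⟦ rename σ s ⟧ₜ ρ) ≤ length (⟦ rename σ t ⟧ₜ ρ)) ⟺ ⟦ s ⊑ t ⟧ (ρ ∘ σ)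
⟦⟧-rename-⊑ σ s t ρ rewrite ⟦⟧ₜ-rename σ s ρ | ⟦⟧ₜ-rename σ t ρ = (λ p → p) , (λ p → p)

¬-cong : ∀ {A B} → A ⟺ B → (¬ A) ⟺ (¬ B)
¬-cong (f , g) = (λ ¬a → ¬a ∘ g) , (λ ¬b → ¬b ∘ f)

_[_≔_] : (Var → Var) → Var → Var → Var → Var
(σ [ x ≔ n ]) y with y ≟ x
... | yes _ = n
... | no _ = σ y

∉⇒Allₜ-≢ : ∀ x t → ¬ OccursIn x t → Allₜ (_≢ x) t
∉⇒Allₜ-≢ x (var y) x∉ = λ y≡x → x∉ (sym y≡x)
∉⇒Allₜ-≢ x e _ = tt
∉⇒Allₜ-≢ x c0 _ = tt
∉⇒Allₜ-≢ x c1 _ = tt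
∉⇒Allₜ-≢ x (s ∘ₜ t) x∉ = ∉⇒Allₜ-≢ x s (x∉ ∘ inj₁) , ∉⇒Allₜ-≢ x t (x∉ ∘ inj₂)

module Binder (σ : Var → Var) (x k : Var) {R : Var → Set} (rb : Below R k) (σ∈R : ∀ y → R (σ y)) where

  σ′ : Var → Var
  σ′ = σ [ x ≔ suc k ]

  σ′∈R : ∀ y → (R ∪ ｛ suc k ｝) (σ′ y)
  σ′∈R y with y ≟ x
  ... | yes _ = inj₂ refl
  ... | no _ = inj₁ (σ∈R y)

  update-rename : ∀ ρ α y → ((ρ [ suc k ↦ α ]) ∘ σ′) y ≡ ((ρ ∘ σ) [ x ↦ α ]) y
  update-rename ρ α y with y ≟ x
  ... | yes _ = update-same ρ (suc k) α
  ... | no _ = update-other ρ α (<⇒≢ (<-trans (rb _ (σ∈R y)) (n<1+n k)))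

  ⟦⟧-update-rename : ∀ φ ρ α → ⟦ φ ⟧ ((ρ [ suc k ↦ α ]) ∘ σ′) ⟺ ⟦ φ ⟧ ((ρ ∘ σ) [ x ↦ α ])
  ⟦⟧-update-rename φ ρ α = ⟦⟧-agree φ (Allᶠ-U φ) (λ y _ → update-rename ρ α y)

  bound-rename : ∀ t → ¬ OccursIn x t → ∀ ρ α →
    (length α ≤ length (⟦ rename σ t ⟧ₜ ρ)) ⟺ ⟦ var x ⊑ t ⟧ ((ρ ∘ σ) [ x ↦ α ])
  bound-rename t x∉t ρ α rewrite ⟦⟧ₜ-rename σ t ρ = ⟺-sym (⊑-update (ρ ∘ σ) x α t (∉⇒Allₜ-≢ x t x∉t))

pure : ∀ {φ} → IsΣ φ → Bool
pure (eqΣ s t) = true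
pure (neqΣ s t) = true
pure (leΣ s t) = true
pure (nleΣ s t) = true
pure (andΣ d₁ d₂) = pure d₁ ∧ pure d₂
pure (orΣ d₁ d₂) = pure d₁ ∧ pure d₂
pure (bexΣ x t _ d) = pure d
pure (ballΣ x t _ d) = false
pure (exΣ x d) = pure d

translate : ∀ {φ} (d : IsΣ φ) {R} k (σ : Var → Var) → Below R k → (∀ y → R (σ y)) →
            ∃[ k′ ] Rep R (pure d) k k′ (λ ρ → ⟦ φ ⟧ (ρ ∘ σ))
translate (eqΣ s t) k σ rb σ∈R = _ , Rep-cong (⟦⟧-rename-≐ σ s t)
  (≐-Rep k (rename σ s) (rename σ t) rb (Allₜ-rename σ s σ∈R) (Allₜ-rename σ t σ∈R))
translate (neqΣ s t) k σ rb σ∈R = _ , Rep-cong (¬-cong ∘ ⟦⟧-rename-≐ σ s t)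
  (≢-Rep k (rename σ s) (rename σ t) rb (Allₜ-rename σ s σ∈R) (Allₜ-rename σ t σ∈R))
translate (leΣ s t) k σ rb σ∈R = _ , Rep-cong (⟦⟧-rename-⊑ σ s t)
  (⊑-Rep k (rename σ s) (rename σ t) rb (Allₜ-rename σ s σ∈R) (Allₜ-rename σ t σ∈R))
translate (nleΣ s t) k σ rb σ∈R = _ , Rep-cong (¬-cong ∘ ⟦⟧-rename-⊑ σ s t)
  (⋢-Rep k (rename σ s) (rename σ t) rb (Allₜ-rename σ s σ∈R) (Allₜ-rename σ t σ∈R))
translate (andΣ d₁ d₂) k σ rb σ∈R
  with k₁ , A ← translate d₁ (1 + k) σ (Below-mono rb (n≤1+n k)) σ∈R
  with k₂ , B ← translate d₂ k₁ σ (Below-mono rb (<⇒≤ (<-trans (n<1+n k) (Rep-< A)))) σ∈R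
  = k₂ , ∧-Rep rb A B
translate (orΣ d₁ d₂) k σ rb σ∈R
  with k₁ , A ← translate d₁ (3 + k) σ (Below-mono rb (m≤n+m k 3)) σ∈R
  with k₂ , B ← translate d₂ (2 + k₁) σ
                  (Below-mono rb (≤-trans (<⇒≤ (<-trans (m≤n+m (suc k) 2) (Rep-< A))) (m≤n+m k₁ 2))) σ∈R
  = 2 + k₂ , ∨-Rep rb A B
translate (bexΣ {φ} x t x∉t d) k σ rb σ∈R
  with k₁ , A ← translate d (2 + k) (σ [ x ≔ suc k ]) (Below-∪ rb) (Binder.σ′∈R σ x k rb σ∈R)
  = k₁ , Rep-cong (λ ρ → (λ (α , α⊑ , p) → α , proj₁ (bound-rename t x∉t ρ α) α⊑ , proj₁ (⟦⟧-update-rename φ ρ α) p) ,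
                         (λ (α , α⊑ , p) → α , proj₂ (bound-rename t x∉t ρ α) α⊑ , proj₂ (⟦⟧-update-rename φ ρ α) p))
                 (Quantifier.∃⊑-Rep rb A (rename σ t) (Allₜ-rename σ t σ∈R))
  where open Binder σ x k rb σ∈R
translate (ballΣ {φ} x t x∉t d) k σ rb σ∈R
  with k₁ , A ← translate d (2 + k) (σ [ x ≔ suc k ]) (Below-∪ rb) (Binder.σ′∈R σ x k rb σ∈R)
  = k₁ , Rep-cong (λ ρ → (λ f α α⊑ → proj₁ (⟦⟧-update-rename φ ρ α) (f α (proj₂ (bound-rename t x∉t ρ α) α⊑))) ,
                         (λ f α α⊑ → proj₂ (⟦⟧-update-rename φ ρ α) (f α (proj₁ (bound-rename t x∉t ρ α) α⊑))))
                 (Quantifier.∀⊑-Rep rb A (rename σ t) (Allₜ-rename σ t σ∈R))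
  where open Binder σ x k rb σ∈R
translate (exΣ {φ} x d) k σ rb σ∈R
  with k₁ , A ← translate d (2 + k) (σ [ x ≔ suc k ]) (Below-∪ rb) (Binder.σ′∈R σ x k rb σ∈R)
  = k₁ , Rep-cong (λ ρ → (λ (α , p) → α , proj₁ (⟦⟧-update-rename φ ρ α) p) ,
                         (λ (α , p) → α , proj₂ (⟦⟧-update-rename φ ρ α) p))
                 (Quantifier.∃-Rep rb A)
  where open Binder σ x k rb σ∈R

varBoundₜ : Term → ℕ
varBoundₜ (var x) = suc x
varBoundₜ e = 0
varBoundₜ c0 = 0
varBoundₜ c1 = 0
varBoundₜ (s ∘ₜ t) = varBoundₜ s ⊔ varBoundₜ t

varBound : Fm → ℕ
varBound (s ≐ t) = varBoundₜ s ⊔ varBoundₜ t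
varBound (s ⊑ t) = varBoundₜ s ⊔ varBoundₜ t
varBound (¬ᶠ φ) = varBound φ
varBound (φ ∧ᶠ ψ) = varBound φ ⊔ varBound ψ
varBound (φ ∨ᶠ ψ) = varBound φ ⊔ varBound ψ
varBound (φ ⇒ᶠ ψ) = varBound φ ⊔ varBound ψ
varBound (∃ᶠ x φ) = suc x ⊔ varBound φ
varBound (∀ᶠ x φ) = suc x ⊔ varBound φ

Allₜ-varBound : ∀ t {n} → varBoundₜ t ≤ n → Allₜ (_< n) t
Allₜ-varBound (var x) h = h
Allₜ-varBound e h = tt
Allₜ-varBound c0 h = tt
Allₜ-varBound c1 h = tt
Allₜ-varBound (s ∘ₜ t) h = Allₜ-varBound s (m⊔n≤o⇒m≤o _ _ h) , Allₜ-varBound t (m⊔n≤o⇒n≤o _ _ h)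

Allᶠ-varBound : ∀ φ {n} → varBound φ ≤ n → Allᶠ (_< n) φ
Allᶠ-varBound (s ≐ t) h = Allₜ-varBound s (m⊔n≤o⇒m≤o _ _ h) , Allₜ-varBound t (m⊔n≤o⇒n≤o _ _ h)
Allᶠ-varBound (s ⊑ t) h = Allₜ-varBound s (m⊔n≤o⇒m≤o _ _ h) , Allₜ-varBound t (m⊔n≤o⇒n≤o _ _ h)
Allᶠ-varBound (¬ᶠ φ) h = Allᶠ-varBound φ h
Allᶠ-varBound (φ ∧ᶠ ψ) h = Allᶠ-varBound φ (m⊔n≤o⇒m≤o _ _ h) , Allᶠ-varBound ψ (m⊔n≤o⇒n≤o _ _ h)
Allᶠ-varBound (φ ∨ᶠ ψ) h = Allᶠ-varBound φ (m⊔n≤o⇒m≤o _ _ h) , Allᶠ-varBound ψ (m⊔n≤o⇒n≤o _ _ h)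
Allᶠ-varBound (φ ⇒ᶠ ψ) h = Allᶠ-varBound φ (m⊔n≤o⇒m≤o _ _ h) , Allᶠ-varBound ψ (m⊔n≤o⇒n≤o _ _ h)
Allᶠ-varBound (∃ᶠ x φ) h = m⊔n≤o⇒m≤o (suc x) (varBound φ) h , Allᶠ-varBound φ (m⊔n≤o⇒n≤o _ _ h)
Allᶠ-varBound (∀ᶠ x φ) h = m⊔n≤o⇒m≤o (suc x) (varBound φ) h , Allᶠ-varBound φ (m⊔n≤o⇒n≤o _ _ h)

-- Variables ≥ n do not occur in the formula at hand; they are sent to 0.
clamp : ℕ → Var → Var
clamp n y with suc y ≤? n
... | yes _ = y
... | no _ = 0

clamp-< : ∀ n y → clamp (suc n) y < suc n
clamp-< n y with suc y ≤? suc n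
... | yes y<n = y<n
... | no _ = s≤s z≤n

clamp-id : ∀ n y → y < n → clamp n y ≡ y
clamp-id n y y<n with suc y ≤? n
... | yes _ = refl
... | no y≮n = ⊥-elim (y≮n y<n)

Σ-Rep : ∀ {φ} (d : IsΣ φ) → ∃[ N ] ∃[ k′ ] Rep (_< N) (pure d) N k′ ⟦ φ ⟧
Σ-Rep {φ} d with k′ , A ← translate d (suc (varBound φ)) (clamp (suc (varBound φ))) (λ _ v<N → v<N) (clamp-< (varBound φ))
  = suc (varBound φ) , k′ , Rep-cong (λ ρ → ⟺-sym (clamp-faithful ρ)) A
  where
  clamp-faithful : ∀ ρ → ⟦ φ ⟧ ρ ⟺ ⟦ φ ⟧ (ρ ∘ clamp (suc (varBound φ)))
  clamp-faithful ρ = ⟦⟧-agree φ (Allᶠ-varBound φ (n≤1+n _)) (λ v v<N → cong ρ (sym (clamp-id _ v v<N)))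

Rep⇒NormalForm : ∀ {R b k k′ φ} (A : Rep R b k k′ ⟦ φ ⟧) → φ ≈𝔉 NormalForm k (prefix A) (lhs A) (rhs A)
Rep⇒NormalForm A ρ rewrite prefixForm≡prefixed (prefix A) (lhs A) (rhs A) = ⟺-sym (correct A ρ)

IsPE⇒IsΣ : ∀ {φ} → IsPE φ → IsΣ φ
IsPE⇒IsΣ (eqP s t) = eqΣ s t
IsPE⇒IsΣ (neqP s t) = neqΣ s t
IsPE⇒IsΣ (leP s t) = leΣ s t
IsPE⇒IsΣ (nleP s t) = nleΣ s t
IsPE⇒IsΣ (andP p q) = andΣ (IsPE⇒IsΣ p) (IsPE⇒IsΣ q)
IsPE⇒IsΣ (orP p q) = orΣ (IsPE⇒IsΣ p) (IsPE⇒IsΣ q)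
IsPE⇒IsΣ (bexP x t x∉t p) = bexΣ x t x∉t (IsPE⇒IsΣ p)
IsPE⇒IsΣ (exP x p) = exΣ x (IsPE⇒IsΣ p)

pure-IsPE : ∀ {φ} (p : IsPE φ) → T (pure (IsPE⇒IsΣ p))
pure-IsPE (eqP s t) = tt
pure-IsPE (neqP s t) = tt
pure-IsPE (leP s t) = tt
pure-IsPE (nleP s t) = tt
pure-IsPE (andP p q) = Equivalence.from T-∧ (pure-IsPE p , pure-IsPE q)
pure-IsPE (orP p q) = Equivalence.from T-∧ (pure-IsPE p , pure-IsPE q)
pure-IsPE (bexP x t _ p) = pure-IsPE p
pure-IsPE (exP x p) = pure-IsPE p

bindings : Prefix → List (Var × Term)
bindings = map proj₂

Window-∉ : ∀ {lo hi} qs → Window lo hi qs → ∀ {x} → x < lo → x ∉ map proj₁ (bindings qs)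
Window-∉ ((_ , v , _) ∷ qs) (lo≤v , _ , w) x<lo (here x≡v) = <⇒≢ (<-≤-trans x<lo lo≤v) x≡v
Window-∉ ((_ , v , _) ∷ qs) (lo≤v , _ , w) x<lo (there x∈) =
  Window-∉ qs w (<-trans (<-≤-trans x<lo lo≤v) (n<1+n v)) x∈

∧-exists* : ∀ vs F φ → Allᶠ (_∉ vs) F → (F ∧ᶠ exists* vs φ) ≋ exists* vs (F ∧ᶠ φ)
∧-exists* [] F φ h = ≋-refl
∧-exists* (w ∷ ws) F φ h = ≋-trans
  (mk≋ λ ρ → (λ (f , a , p) → a , proj₂ (⟦⟧-update-fresh F w w-fresh ρ a) f , p) ,
             (λ (a , f , p) → proj₁ (⟦⟧-update-fresh F w w-fresh ρ a) f , a , p))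
  (∃-cong w (∧-exists* ws F φ (Allᶠ-mono (_∘ there) F h)))
  where
  w-fresh : Allᶠ (_≢ w) F
  w-fresh = Allᶠ-mono (_∘ here) F h

prefixed-existential : ∀ {lo hi} qs → Window lo hi qs → Existential qs → ∀ s t →
  prefixed qs (s ≐ t) ≋ exists* (map proj₁ (bindings qs)) (boundConj (bindings qs) s t)
prefixed-existential [] _ [] s t = ≋-refl
prefixed-existential ((qex , v , u) ∷ qs) (_ , u<v , w) (refl ∷ ex) s t =
  ∃-cong v (≋-trans (∧-cong ≋-refl (prefixed-existential qs w ex s t)) (∧-exists* _ (var v ⊑ u) _ fresh))
  where
  fresh : Allᶠ (_∉ map proj₁ (bindings qs)) (var v ⊑ u)
  fresh = Window-∉ qs w (n<1+n v) , Allₜ-mono (λ x<v → Window-∉ qs w (<-trans x<v (n<1+n v))) u u<v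

Rep⇒ExNormalForm : ∀ {R b k k′ φ} (A : Rep R b k k′ ⟦ φ ⟧) → T b →
  φ ≈𝔉 ExNormalForm k (bindings (prefix A)) (lhs A) (rhs A)
Rep⇒ExNormalForm A hb ρ = ⟺-trans (⟺-sym (correct A ρ))
  (at (∃-cong _ (prefixed-existential (prefix A) (window A) (existential A hb) (lhs A) (rhs A))) ρ)

theorem9 : (φ : Fm) → IsΣ φ →
    (∃[ v₀ ] ∃[ qs ] ∃[ s ] ∃[ t ] (φ ≈𝔉 NormalForm v₀ qs s t))
    × (IsPE φ → ∃[ v₀ ] ∃[ bs ] ∃[ s ] ∃[ t ] (φ ≈𝔉 ExNormalForm v₀ bs s t))
theorem9 φ d =
  (let N , _ , A = Σ-Rep d in N , prefix A , lhs A , rhs A , Rep⇒NormalForm A) ,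
  (λ pe → let N , _ , A = Σ-Rep (IsPE⇒IsΣ pe) in
          N , bindings (prefix A) , lhs A , rhs A , Rep⇒ExNormalForm A (pure-IsPE pe))
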